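{- Let $f$ be a Boolean function on $n$ variables and let $p=\Pr[f=\mathrm{true}]$. Then $\mathbf{I}[f\sqcap\iota]=\tfrac12\mathbf{I}[f]+p$, $\mathbf{I}[f\sqcup\iota]=\tfrac12\mathbf{I}[f]+1-p$, and $\mathbf{H}[f\sqcap\iota]=\mathbf{H}[f\sqcup\iota]=\tfrac12\mathbf{H}[f]-\tfrac12\tilde h(p)+2h(p)$.
   Context: $\mathrm{true}=-1$, $\mathrm{false}=+1$; probabilities over uniform inputs. For a Boolean function $f:\{ -1,1\}^n\to\{ -1,1\}$, $\hat f(S)=\mathbf{E}_x[f(x)\prod_{i\in S}x_i]$, $\mathbf{I}[f]=\sum_S\hat f(S)^2|S|$, $\mathbf{H}[f]=-\sum_S\hat f(S)^2\log_2\hat f(S)^2$. $\iota$ is the one-variable identity function. $(f\sqcap\iota)(x_1,\dots,x_{n+1})=f(x_1,\dots,x_n)\wedge x_{n+1}$ and $(f\sqcup\iota)(x_1,\dots,x_{n+1})=f(x_1,\dots,x_n)\vee x_{n+1}$. $h(p)=-p\log_2p-(1-p)\log_2(1-p)$ ($h(0)=h(1)=0$) and $\tilde h(p)=h(4p(1-p))$. -}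

module Defs where

open import Data.Bool using (Bool; true; false; _∧_; _∨_; if_then_else_)
open import Data.Nat as ℕ using (ℕ; zero; suc)
open import Data.Integer as ℤ using (ℤ; +_; -[1+_])
open import Data.Rational as ℚ using (ℚ; 0ℚ; 1ℚ; ½; -½; ↥_; ↧ₙ_; _+_; _*_; _-_; -_; _≟_)
open import Data.Vec using (Vec; []; _∷_; init; last)
open import Data.List as List using (List; []; _∷_; _++_; [_])
open import Data.List.Relation.Unary.All using (All)
open import Data.Product using (_×_; _,_; Σ; proj₁; proj₂)
open import Relation.Binary.PropositionalEquality using (_≡_)
open import Relation.Nullary using (yes; no)

-- Boolean functions on n variables.  Bool `true` encodes the truth value
-- true, whose ±1 representation is -1; `false` is +1.
BoolFun : ℕ → Set
BoolFun n = Vec Bool n → Bool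

sgn : Bool → ℚ
sgn true  = - 1ℚ
sgn false = 1ℚ

E : (n : ℕ) → (Vec Bool n → ℚ) → ℚ
E zero    g = g []
E (suc n) g = ½ * (E n (λ x → g (false ∷ x)) + E n (λ x → g (true ∷ x)))

-- Sum over all subsets S ⊆ [n] (S given by its indicator vector).
ΣS : (n : ℕ) → (Vec Bool n → ℚ) → ℚ
ΣS zero    g = g []
ΣS (suc n) g = ΣS n (λ S → g (false ∷ S)) + ΣS n (λ S → g (true ∷ S))

subsets : (n : ℕ) → List (Vec Bool n)
subsets zero    = [ [] ]
subsets (suc n) = List.map (false ∷_) (subsets n) ++ List.map (true ∷_) (subsets n)

χ : {n : ℕ} → Vec Bool n → Vec Bool n → ℚ
χ []            []       = 1ℚ
χ (false ∷ S) (_ ∷ x)    = χ S x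
χ (true  ∷ S) (b ∷ x)    = sgn b * χ S x

card : {n : ℕ} → Vec Bool n → ℕ
card []          = 0
card (false ∷ S) = card S
card (true ∷ S)  = suc (card S)

fhat : {n : ℕ} → BoolFun n → Vec Bool n → ℚ
fhat {n} f S = E n (λ x → sgn (f x) * χ S x)

Inf : {n : ℕ} → BoolFun n → ℚ
Inf {n} f = ΣS n (λ S → fhat f S * fhat f S * (+ card S ℚ./ 1))

Pr-true : {n : ℕ} → BoolFun n → ℚ
Pr-true {n} f = E n (λ x → if f x then 1ℚ else 0ℚ)

-- f ⊓ ι and f ⊔ ι : the new variable x_{n+1} is the last coordinate.
_⊓ι : {n : ℕ} → BoolFun n → BoolFun (suc n)
(f ⊓ι) x = f (init x) ∧ last x

_⊔ι : {n : ℕ} → BoolFun n → BoolFun (suc n)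
(f ⊔ι) x = f (init x) ∨ last x

-- Real numbers of the form Σ c_i · log₂ q_i  (c_i ∈ ℚ, q_i ∈ ℚ, q_i > 0),
-- represented as formal lists of pairs (c_i , q_i).

LogSum : Set
LogSum = List (ℚ × ℚ)

-- c · log₂ a, with the convention 0·log 0 = 0 (term omitted if a = 0).
clog : ℚ → ℚ → LogSum
clog c a with a ≟ 0ℚ
... | yes _ = []
... | no  _ = [ (c , a) ]

scale : ℚ → LogSum → LogSum
scale k = List.map (λ t → (k * proj₁ t , proj₂ t))

powℚ : ℚ → ℕ → ℚ
powℚ q zero    = 1ℚ
powℚ q (suc k) = q * powℚ q k

IntegralAt : ℕ → LogSum → Set
IntegralAt D L = All (λ t → ↧ₙ ((+ D ℚ./ 1) * proj₁ t) ≡ 1) L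

posPart negPart : ℕ → LogSum → ℚ
posPart D [] = 1ℚ
posPart D ((c , q) ∷ L) with ↥ ((+ D ℚ./ 1) * c)
... | + k      = powℚ q k * posPart D L
... | -[1+ k ] = posPart D L
negPart D [] = 1ℚ
negPart D ((c , q) ∷ L) with ↥ ((+ D ℚ./ 1) * c)
... | + k      = negPart D L
... | -[1+ k ] = powℚ q (suc k) * negPart D L

-- Equality of the real numbers denoted:  Σ c log q = Σ d log r
-- iff for some D ≥ 1 making all exponents integral,
--   ∏ q^{D c} = ∏ r^{D d}  (exponentiate by 2^D·(·), using injectivity).
_≈L_ : LogSum → LogSum → Set
L₁ ≈L L₂ = Σ ℕ λ D → (D ℕ.≥ 1) × IntegralAt D L₁ × IntegralAt D L₂ ×
  (posPart D L₁ * negPart D L₂ ≡ posPart D L₂ * negPart D L₁)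

Ent : {n : ℕ} → BoolFun n → LogSum
Ent {n} f = List.concatMap (λ S → let a = fhat f S * fhat f S in clog (- a) a) (subsets n)

hbin : ℚ → LogSum
hbin p = clog (- p) p ++ clog (- (1ℚ - p)) (1ℚ - p)

htilde : ℚ → LogSum
htilde p = hbin ((+ 4 ℚ./ 1) * p * (1ℚ - p))

entRHS : {n : ℕ} → BoolFun n → LogSum
entRHS f = scale ½ (Ent f) ++ scale -½ (htilde (Pr-true f)) ++ scale (+ 2 ℚ./ 1) (hbin (Pr-true f))

{-# OPTIONS --safe #-}
module Submission where

-- Splitting off the new last coordinate, the Fourier coefficient of f ⊓ι at S ∪ {n+1}^β (containing
-- n+1 iff β) is ½(δ_{S=∅} ± f̂(S)), and that of f ⊔ι is ½(f̂(S) ∓ δ_{S=∅}).  Summing their squares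
-- with weight |T| gives ½ I[f] + ¼ Σ_S (f̂(S) ∓ δ_{S=∅})², which Parseval and f̂(∅) = 1 - 2p evaluate
-- to p, resp. 1 - p.  For the entropy, both coefficients over a nonempty S have square ¼ f̂(S)², while
-- over ∅ the squares are p² and (1 - p)²; by Parseval, H[f ⊓ι] - ½ H[f] is then a function of p alone.
-- Since ℚ has no logarithms, the entropy identity is checked after exponentiating 2^(D · _) with
-- D = 4^(n+1): 2^(n+1) times a Fourier coefficient of a function of n+1 bits is an integer, so every
-- D·c is an integer and both sides become products of natural powers of the Fourier weights, of p,
-- 1 - p and 4; the identity then reduces to Parseval and an identity between exponents.

open import Level using (0ℓ)
open import Algebra.Bundles using (CommutativeMonoid; CommutativeRing)
open import Data.Bool using (Bool; true; false; not; if_then_else_; _∧_; _∨_)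
open import Data.Bool.Properties using (∧-zeroʳ; ∧-identityʳ; ∨-zeroʳ; ∨-identityʳ)
open import Data.Nat as ℕ using (ℕ; zero; suc)
import Data.Nat.Properties as ℕ
import Data.Nat.Coprimality as Coprime
import Data.Nat.Tactic.RingSolver as ℕ-Solver
open import Data.Integer as ℤ using (ℤ)
import Data.Integer.Properties as ℤ
import Data.Integer.Tactic.RingSolver as ℤ-Solver
open import Data.Rational using (ℚ; 0ℚ; 1ℚ; ½; -½; _/_; ↥_; ↧ₙ_; _+_; _*_; -_; _-_; _≟_)
open import Data.Rational.Literals using (fromℤ)
open import Data.Rational.Properties
import Data.Rational.Unnormalised.Properties as ℚᵘ
open import Data.Rational.Unnormalised.Base using (*≡*)
open import Data.Product using (Σ; _×_; _,_; proj₁; proj₂)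
open import Data.List using ([]; _∷_; _++_; map; concatMap)
open import Data.List.Properties using (map-++; map-concatMap; concatMap-++; concatMap-map; concatMap-cong)
open import Data.List.Relation.Unary.All using ([]; _∷_)
open import Data.List.Relation.Unary.All.Properties using (++⁺)
open import Data.Vec using (Vec; []; _∷_; _∷ʳ_; replicate)
open import Data.Vec.Properties using (init-∷ʳ; last-∷ʳ)
open import Relation.Binary.PropositionalEquality
open import Relation.Nullary using (yes; no)
open import Relation.Nullary.Decidable using (dec⇒maybe)
open import Tactic.RingSolver using (solve-∀)
import Tactic.RingSolver.Core.AlmostCommutativeRing as ACR
open import Algebra.Properties.CommutativeSemiring.Exp (CommutativeRing.commutativeSemiring +-*-commutativeRing)
  using (_^_; ^-homo-*; ^-distrib-*)
open import Algebra.Properties.CommutativeSemigroup (CommutativeMonoid.commutativeSemigroup +-0-commutativeMonoid)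
  using () renaming (interchange to +-interchange)
open import Algebra.Properties.CommutativeSemigroup (CommutativeMonoid.commutativeSemigroup *-1-commutativeMonoid)
  using () renaming (interchange to *-interchange)

open import Defs

ℚ-ring : ACR.AlmostCommutativeRing 0ℓ 0ℓ
ℚ-ring = ACR.fromCommutativeRing +-*-commutativeRing (λ x → dec⇒maybe (0ℚ ≟ x))

-- Definitionally the `+ k ℚ./ 1` of Defs (the weights |S| in Inf, the scaling D in posPart); unlike
-- `fromℤ`, its numerator is not a literal, so `↥` and unification do not see through it.
fromℕ : ℕ → ℚ
fromℕ k = ℤ.+ k / 1

/1≡fromℤ : ∀ z → z / 1 ≡ fromℤ z
/1≡fromℤ (ℤ.+ k)    = normalize-coprime (Coprime.sym (Coprime.1-coprimeTo k))
/1≡fromℤ ℤ.-[1+ k ] = cong -_ (normalize-coprime (Coprime.sym (Coprime.1-coprimeTo (suc k))))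

fromℤ-+ : ∀ a b → fromℤ (a ℤ.+ b) ≡ fromℤ a + fromℤ b
fromℤ-+ a b = toℚᵘ-injective (ℚᵘ.≃-trans (*≡* (eq a b)) (ℚᵘ.≃-sym (toℚᵘ-homo-+ (fromℤ a) (fromℤ b))))
  where
  eq : ∀ a b → (a ℤ.+ b) ℤ.* ℤ.+ 1 ≡ (a ℤ.* ℤ.+ 1 ℤ.+ b ℤ.* ℤ.+ 1) ℤ.* ℤ.+ 1
  eq = ℤ-Solver.solve-∀

fromℤ-* : ∀ a b → fromℤ (a ℤ.* b) ≡ fromℤ a * fromℤ b
fromℤ-* a b = toℚᵘ-injective (ℚᵘ.≃-trans (*≡* refl) (ℚᵘ.≃-sym (toℚᵘ-homo-* (fromℤ a) (fromℤ b))))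

fromℤ-injective : ∀ {a b} → fromℤ a ≡ fromℤ b → a ≡ b
fromℤ-injective = cong ↥_

fromℕ≡fromℤ : ∀ k → fromℕ k ≡ fromℤ (ℤ.+ k)
fromℕ≡fromℤ k = /1≡fromℤ (ℤ.+ k)

-fromℕ≡fromℤ : ∀ k → - fromℕ k ≡ fromℤ (ℤ.- ℤ.+ k)
-fromℕ≡fromℤ k = trans (cong -_ (fromℕ≡fromℤ k)) (-fromℤ k)
  where
  -fromℤ : ∀ k → - fromℤ (ℤ.+ k) ≡ fromℤ (ℤ.- ℤ.+ k)
  -fromℤ zero    = refl
  -fromℤ (suc k) = refl

fromℕ-+ : ∀ a b → fromℕ (a ℕ.+ b) ≡ fromℕ a + fromℕ b
fromℕ-+ a b = begin
  fromℕ (a ℕ.+ b)                   ≡⟨ fromℕ≡fromℤ (a ℕ.+ b) ⟩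
  fromℤ (ℤ.+ a ℤ.+ ℤ.+ b)           ≡⟨ fromℤ-+ (ℤ.+ a) (ℤ.+ b) ⟩
  fromℤ (ℤ.+ a) + fromℤ (ℤ.+ b)     ≡⟨ cong₂ _+_ (fromℕ≡fromℤ a) (fromℕ≡fromℤ b) ⟨
  fromℕ a + fromℕ b                 ∎
  where open ≡-Reasoning

fromℕ-* : ∀ a b → fromℕ (a ℕ.* b) ≡ fromℕ a * fromℕ b
fromℕ-* a b = begin
  fromℕ (a ℕ.* b)                   ≡⟨ fromℕ≡fromℤ (a ℕ.* b) ⟩
  fromℤ (ℤ.+ (a ℕ.* b))             ≡⟨ cong fromℤ (ℤ.pos-* a b) ⟩
  fromℤ (ℤ.+ a ℤ.* ℤ.+ b)           ≡⟨ fromℤ-* (ℤ.+ a) (ℤ.+ b) ⟩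
  fromℤ (ℤ.+ a) * fromℤ (ℤ.+ b)     ≡⟨ cong₂ _*_ (fromℕ≡fromℤ a) (fromℕ≡fromℤ b) ⟨
  fromℕ a * fromℕ b                 ∎
  where open ≡-Reasoning

fromℕ-injective : ∀ {a b} → fromℕ a ≡ fromℕ b → a ≡ b
fromℕ-injective {a} {b} e =
  ℤ.+-injective (fromℤ-injective (trans (sym (fromℕ≡fromℤ a)) (trans e (fromℕ≡fromℤ b))))

powℚ≡^ : ∀ x k → powℚ x k ≡ x ^ k
powℚ≡^ x zero    = refl
powℚ≡^ x (suc k) = cong (x *_) (powℚ≡^ x k)

-- Sums, averages and products over the cube

∅ : ∀ {n} → Vec Bool n
∅ {n} = replicate n false

δ∅ : ∀ {n} → Vec Bool n → ℚ
δ∅ []          = 1ℚ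
δ∅ (false ∷ S) = δ∅ S
δ∅ (true  ∷ S) = 0ℚ

δ∅-∅ : ∀ n → δ∅ (∅ {n}) ≡ 1ℚ
δ∅-∅ zero    = refl
δ∅-∅ (suc n) = δ∅-∅ n

δ∅-idem : ∀ {n} (S : Vec Bool n) → δ∅ S * δ∅ S ≡ δ∅ S
δ∅-idem []          = refl
δ∅-idem (false ∷ S) = δ∅-idem S
δ∅-idem (true  ∷ S) = refl

δ∅-card : ∀ {n} (S : Vec Bool n) → δ∅ S * fromℕ (card S) ≡ 0ℚ
δ∅-card []          = refl
δ∅-card (false ∷ S) = δ∅-card S
δ∅-card (true  ∷ S) = *-zeroˡ (fromℕ (suc (card S)))

weighted-δ∅ : ∀ {n} (S : Vec Bool n) x → (x + δ∅ S * δ∅ S) * fromℕ (card S) ≡ x * fromℕ (card S)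
weighted-δ∅ S x = begin
  (x + d * d) * c       ≡⟨ distribute x d c ⟩
  x * c + d * (d * c)   ≡⟨ cong (λ e → x * c + d * e) (δ∅-card S) ⟩
  x * c + d * 0ℚ        ≡⟨ annihilate (x * c) d ⟩
  x * c                 ∎
  where
  open ≡-Reasoning
  d c : ℚ
  d = δ∅ S
  c = fromℕ (card S)
  distribute : ∀ x d c → (x + d * d) * c ≡ x * c + d * (d * c)
  distribute = solve-∀ ℚ-ring
  annihilate : ∀ y d → y + d * 0ℚ ≡ y
  annihilate = solve-∀ ℚ-ring

card-∷ʳ : ∀ {n} (S : Vec Bool n) β → card (S ∷ʳ β) ≡ card S ℕ.+ (if β then 1 else 0)
card-∷ʳ []          true  = refl
card-∷ʳ []          false = refl
card-∷ʳ (false ∷ S) β     = card-∷ʳ S β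
card-∷ʳ (true  ∷ S) β     = cong suc (card-∷ʳ S β)

fromℕ-card-∷ʳ : ∀ {n} (S : Vec Bool n) β →
                fromℕ (card (S ∷ʳ β)) ≡ fromℕ (card S) + (if β then 1ℚ else 0ℚ)
fromℕ-card-∷ʳ S true  = trans (cong fromℕ (card-∷ʳ S true)) (fromℕ-+ (card S) 1)
fromℕ-card-∷ʳ S false = trans (cong fromℕ (card-∷ʳ S false)) (fromℕ-+ (card S) 0)

ΣS-cong : ∀ n {g h : Vec Bool n → ℚ} → (∀ S → g S ≡ h S) → ΣS n g ≡ ΣS n h
ΣS-cong zero    g≗h = g≗h []
ΣS-cong (suc n) g≗h = cong₂ _+_ (ΣS-cong n (λ S → g≗h (false ∷ S))) (ΣS-cong n (λ S → g≗h (true ∷ S)))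

ΣS-+ : ∀ n (g h : Vec Bool n → ℚ) → ΣS n (λ S → g S + h S) ≡ ΣS n g + ΣS n h
ΣS-+ zero    g h = refl
ΣS-+ (suc n) g h =
  trans (cong₂ _+_ (ΣS-+ n g₀ h₀) (ΣS-+ n g₁ h₁)) (+-interchange (ΣS n g₀) (ΣS n h₀) (ΣS n g₁) (ΣS n h₁))
  where
  g₀ g₁ h₀ h₁ : Vec Bool n → ℚ
  g₀ S = g (false ∷ S)
  g₁ S = g (true ∷ S)
  h₀ S = h (false ∷ S)
  h₁ S = h (true ∷ S)

ΣS-* : ∀ n c (g : Vec Bool n → ℚ) → ΣS n (λ S → c * g S) ≡ c * ΣS n g
ΣS-* zero    c g = refl
ΣS-* (suc n) c g = trans (cong₂ _+_ (ΣS-* n c g₀) (ΣS-* n c g₁)) (sym (*-distribˡ-+ c (ΣS n g₀) (ΣS n g₁)))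
  where
  g₀ g₁ : Vec Bool n → ℚ
  g₀ S = g (false ∷ S)
  g₁ S = g (true ∷ S)

ΣS-∷ʳ : ∀ n (g : Vec Bool (suc n) → ℚ) → ΣS (suc n) g ≡ ΣS n (λ S → g (S ∷ʳ false) + g (S ∷ʳ true))
ΣS-∷ʳ zero    g = refl
ΣS-∷ʳ (suc n) g = cong₂ _+_ (ΣS-∷ʳ n (λ S → g (false ∷ S))) (ΣS-∷ʳ n (λ S → g (true ∷ S)))

ΣS-δ∅ : ∀ n (h : Vec Bool n → ℚ) → ΣS n (λ S → δ∅ S * h S) ≡ h ∅
ΣS-δ∅ zero    h = *-identityˡ (h [])
ΣS-δ∅ (suc n) h = begin
  ΣS n (λ S → δ∅ S * h₀ S) + ΣS n (λ S → 0ℚ * h₁ S)  ≡⟨ cong₂ _+_ (ΣS-δ∅ n h₀) (ΣS-* n 0ℚ h₁) ⟩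
  h ∅ + 0ℚ * ΣS n h₁                                 ≡⟨ cong (h ∅ +_) (*-zeroˡ (ΣS n h₁)) ⟩
  h ∅ + 0ℚ                                           ≡⟨ +-identityʳ (h ∅) ⟩
  h ∅                                                ∎
  where
  open ≡-Reasoning
  h₀ h₁ : Vec Bool n → ℚ
  h₀ S = h (false ∷ S)
  h₁ S = h (true ∷ S)

ΣS-closed : (P : ℚ → Set) → (∀ {x y} → P x → P y → P (x + y)) →
            ∀ n {g : Vec Bool n → ℚ} → (∀ S → P (g S)) → P (ΣS n g)
ΣS-closed P P-+ zero    P-g = P-g []
ΣS-closed P P-+ (suc n) P-g =
  P-+ (ΣS-closed P P-+ n (λ S → P-g (false ∷ S))) (ΣS-closed P P-+ n (λ S → P-g (true ∷ S)))

E-cong : ∀ n {g h : Vec Bool n → ℚ} → (∀ x → g x ≡ h x) → E n g ≡ E n h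
E-cong zero    g≗h = g≗h []
E-cong (suc n) g≗h =
  cong₂ (λ a b → ½ * (a + b)) (E-cong n (λ x → g≗h (false ∷ x))) (E-cong n (λ x → g≗h (true ∷ x)))

E-+ : ∀ n (g h : Vec Bool n → ℚ) → E n (λ x → g x + h x) ≡ E n g + E n h
E-+ zero    g h = refl
E-+ (suc n) g h = begin
  ½ * (E n (λ x → g₀ x + h₀ x) + E n (λ x → g₁ x + h₁ x))
    ≡⟨ cong₂ (λ a b → ½ * (a + b)) (E-+ n g₀ h₀) (E-+ n g₁ h₁) ⟩
  ½ * ((E n g₀ + E n h₀) + (E n g₁ + E n h₁))
    ≡⟨ cong (½ *_) (+-interchange (E n g₀) (E n h₀) (E n g₁) (E n h₁)) ⟩
  ½ * ((E n g₀ + E n g₁) + (E n h₀ + E n h₁))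
    ≡⟨ *-distribˡ-+ ½ (E n g₀ + E n g₁) (E n h₀ + E n h₁) ⟩
  E (suc n) g + E (suc n) h
    ∎
  where
  open ≡-Reasoning
  g₀ g₁ h₀ h₁ : Vec Bool n → ℚ
  g₀ x = g (false ∷ x)
  g₁ x = g (true ∷ x)
  h₀ x = h (false ∷ x)
  h₁ x = h (true ∷ x)

E-* : ∀ n c (g : Vec Bool n → ℚ) → E n (λ x → c * g x) ≡ c * E n g
E-* zero    c g = refl
E-* (suc n) c g = trans (cong₂ (λ a b → ½ * (a + b)) (E-* n c g₀) (E-* n c g₁)) (half-linear c (E n g₀) (E n g₁))
  where
  g₀ g₁ : Vec Bool n → ℚ
  g₀ x = g (false ∷ x)
  g₁ x = g (true ∷ x)
  half-linear : ∀ c a b → ½ * (c * a + c * b) ≡ c * (½ * (a + b))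
  half-linear = solve-∀ ℚ-ring

E-const : ∀ n c → E n (λ _ → c) ≡ c
E-const zero    c = refl
E-const (suc n) c = trans (cong (λ a → ½ * (a + a)) (E-const n c)) (half-double c)
  where
  half-double : ∀ c → ½ * (c + c) ≡ c
  half-double = solve-∀ ℚ-ring

E-∷ʳ : ∀ n (g : Vec Bool (suc n) → ℚ) → E (suc n) g ≡ E n (λ x → ½ * (g (x ∷ʳ false) + g (x ∷ʳ true)))
E-∷ʳ zero    g = refl
E-∷ʳ (suc n) g = cong₂ (λ a b → ½ * (a + b)) (E-∷ʳ n (λ x → g (false ∷ x))) (E-∷ʳ n (λ x → g (true ∷ x)))

2^n*E≡ΣS : ∀ n (g : Vec Bool n → ℚ) → fromℕ (2 ℕ.^ n) * E n g ≡ ΣS n g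
2^n*E≡ΣS zero    g = *-identityˡ (g [])
2^n*E≡ΣS (suc n) g = begin
  fromℕ (2 ℕ.* N) * (½ * (E n g₀ + E n g₁))    ≡⟨ cong (_* (½ * (E n g₀ + E n g₁))) (fromℕ-* 2 N) ⟩
  fromℕ 2 * fromℕ N * (½ * (E n g₀ + E n g₁))  ≡⟨ cancel-2½ (fromℕ N) (E n g₀) (E n g₁) ⟩
  fromℕ N * E n g₀ + fromℕ N * E n g₁          ≡⟨ cong₂ _+_ (2^n*E≡ΣS n g₀) (2^n*E≡ΣS n g₁) ⟩
  ΣS n g₀ + ΣS n g₁                            ∎
  where
  open ≡-Reasoning
  N : ℕ
  N = 2 ℕ.^ n
  g₀ g₁ : Vec Bool n → ℚ
  g₀ x = g (false ∷ x)
  g₁ x = g (true ∷ x)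
  cancel-2½ : ∀ ν a b → fromℕ 2 * ν * (½ * (a + b)) ≡ ν * a + ν * b
  cancel-2½ = solve-∀ ℚ-ring

ΠS : (n : ℕ) → (Vec Bool n → ℚ) → ℚ
ΠS zero    g = g []
ΠS (suc n) g = ΠS n (λ S → g (false ∷ S)) * ΠS n (λ S → g (true ∷ S))

ΠS⁺ : (n : ℕ) → (Vec Bool n → ℚ) → ℚ
ΠS⁺ zero    g = 1ℚ
ΠS⁺ (suc n) g = ΠS⁺ n (λ S → g (false ∷ S)) * ΠS n (λ S → g (true ∷ S))

Σℕ : (n : ℕ) → (Vec Bool n → ℕ) → ℕ
Σℕ zero    k = k []
Σℕ (suc n) k = Σℕ n (λ S → k (false ∷ S)) ℕ.+ Σℕ n (λ S → k (true ∷ S))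

ΠS-cong : ∀ n {g h : Vec Bool n → ℚ} → (∀ S → g S ≡ h S) → ΠS n g ≡ ΠS n h
ΠS-cong zero    g≗h = g≗h []
ΠS-cong (suc n) g≗h = cong₂ _*_ (ΠS-cong n (λ S → g≗h (false ∷ S))) (ΠS-cong n (λ S → g≗h (true ∷ S)))

ΠS⁺-cong : ∀ n {g h : Vec Bool n → ℚ} → (∀ S → δ∅ S ≡ 0ℚ → g S ≡ h S) → ΠS⁺ n g ≡ ΠS⁺ n h
ΠS⁺-cong zero    g≗h = refl
ΠS⁺-cong (suc n) g≗h =
  cong₂ _*_ (ΠS⁺-cong n (λ S → g≗h (false ∷ S))) (ΠS-cong n (λ S → g≗h (true ∷ S) refl))

ΠS-* : ∀ n (g h : Vec Bool n → ℚ) → ΠS n (λ S → g S * h S) ≡ ΠS n g * ΠS n h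
ΠS-* zero    g h = refl
ΠS-* (suc n) g h =
  trans (cong₂ _*_ (ΠS-* n g₀ h₀) (ΠS-* n g₁ h₁)) (*-interchange (ΠS n g₀) (ΠS n h₀) (ΠS n g₁) (ΠS n h₁))
  where
  g₀ g₁ h₀ h₁ : Vec Bool n → ℚ
  g₀ S = g (false ∷ S)
  g₁ S = g (true ∷ S)
  h₀ S = h (false ∷ S)
  h₁ S = h (true ∷ S)

ΠS-∷ʳ : ∀ n (g : Vec Bool (suc n) → ℚ) → ΠS (suc n) g ≡ ΠS n (λ S → g (S ∷ʳ false) * g (S ∷ʳ true))
ΠS-∷ʳ zero    g = refl
ΠS-∷ʳ (suc n) g = cong₂ _*_ (ΠS-∷ʳ n (λ S → g (false ∷ S))) (ΠS-∷ʳ n (λ S → g (true ∷ S)))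

ΠS-∅ : ∀ n (g : Vec Bool n → ℚ) → ΠS n g ≡ g ∅ * ΠS⁺ n g
ΠS-∅ zero    g = sym (*-identityʳ (g []))
ΠS-∅ (suc n) g = trans (cong (_* ΠS n g₁) (ΠS-∅ n g₀)) (*-assoc (g ∅) (ΠS⁺ n g₀) (ΠS n g₁))
  where
  g₀ g₁ : Vec Bool n → ℚ
  g₀ S = g (false ∷ S)
  g₁ S = g (true ∷ S)

ΠS-^ : ∀ n x (k : Vec Bool n → ℕ) → ΠS n (λ S → x ^ k S) ≡ x ^ Σℕ n k
ΠS-^ zero    x k = refl
ΠS-^ (suc n) x k = trans (cong₂ _*_ (ΠS-^ n x k₀) (ΠS-^ n x k₁)) (sym (^-homo-* x (Σℕ n k₀) (Σℕ n k₁)))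
  where
  k₀ k₁ : Vec Bool n → ℕ
  k₀ S = k (false ∷ S)
  k₁ S = k (true ∷ S)

ΣS-fromℕ : ∀ n (k : Vec Bool n → ℕ) → ΣS n (λ S → fromℕ (k S)) ≡ fromℕ (Σℕ n k)
ΣS-fromℕ zero    k = refl
ΣS-fromℕ (suc n) k = trans (cong₂ _+_ (ΣS-fromℕ n k₀) (ΣS-fromℕ n k₁)) (sym (fromℕ-+ (Σℕ n k₀) (Σℕ n k₁)))
  where
  k₀ k₁ : Vec Bool n → ℕ
  k₀ S = k (false ∷ S)
  k₁ S = k (true ∷ S)

-- Fourier expansion

coeff : ∀ {n} → (Vec Bool n → ℚ) → Vec Bool n → ℚ
coeff {n} g S = E n (λ x → g x * χ S x)

χ-∷ʳ : ∀ {n} (S x : Vec Bool n) β c → χ (S ∷ʳ β) (x ∷ʳ c) ≡ χ S x * χ (β ∷ []) (c ∷ [])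
χ-∷ʳ []          []      β c = sym (*-identityˡ _)
χ-∷ʳ (false ∷ S) (_ ∷ x) β c = χ-∷ʳ S x β c
χ-∷ʳ (true  ∷ S) (b ∷ x) β c = trans (cong (sgn b *_) (χ-∷ʳ S x β c)) (sym (*-assoc (sgn b) (χ S x) _))

χ-∅ : ∀ {n} (x : Vec Bool n) → χ ∅ x ≡ 1ℚ
χ-∅ []      = refl
χ-∅ (_ ∷ x) = χ-∅ x

E-χ : ∀ n (S : Vec Bool n) → E n (χ S) ≡ δ∅ S
E-χ zero    []          = refl
E-χ (suc n) (false ∷ S) = trans (cong (λ a → ½ * (a + a)) (E-χ n S)) (half-double (δ∅ S))
  where
  half-double : ∀ c → ½ * (c + c) ≡ c
  half-double = solve-∀ ℚ-ring
E-χ (suc n) (true ∷ S)  =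
  trans (cong₂ (λ a b → ½ * (a + b)) (E-* n 1ℚ (χ S)) (E-* n (- 1ℚ) (χ S))) (cancel (E n (χ S)))
  where
  cancel : ∀ a → ½ * (1ℚ * a + - 1ℚ * a) ≡ 0ℚ
  cancel = solve-∀ ℚ-ring

coeff-const : ∀ {n} c (S : Vec Bool n) → coeff (λ _ → c) S ≡ c * δ∅ S
coeff-const {n} c S = trans (E-* n c (χ S)) (cong (c *_) (E-χ n S))

χ-last-false : ∀ β → χ (β ∷ []) (false ∷ []) ≡ 1ℚ
χ-last-false false = refl
χ-last-false true  = refl

χ-last-true : ∀ β → χ (β ∷ []) (true ∷ []) ≡ sgn β
χ-last-true false = refl
χ-last-true true  = refl

coeff-∷ʳ : ∀ {n} (g : Vec Bool (suc n) → ℚ) (S : Vec Bool n) β →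
           coeff g (S ∷ʳ β) ≡ ½ * (coeff (λ x → g (x ∷ʳ false)) S + sgn β * coeff (λ x → g (x ∷ʳ true)) S)
coeff-∷ʳ {n} g S β = begin
  E (suc n) (λ y → g y * χ (S ∷ʳ β) y)
    ≡⟨ E-∷ʳ n (λ y → g y * χ (S ∷ʳ β) y) ⟩
  E n (λ x → ½ * (g₀ x * χ (S ∷ʳ β) (x ∷ʳ false) + g₁ x * χ (S ∷ʳ β) (x ∷ʳ true)))
    ≡⟨ E-cong n split ⟩
  E n (λ x → ½ * (g₀ x * χ S x) + (½ * sgn β) * (g₁ x * χ S x))
    ≡⟨ E-+ n (λ x → ½ * (g₀ x * χ S x)) (λ x → (½ * sgn β) * (g₁ x * χ S x)) ⟩
  E n (λ x → ½ * (g₀ x * χ S x)) + E n (λ x → (½ * sgn β) * (g₁ x * χ S x))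
    ≡⟨ cong₂ _+_ (E-* n ½ (λ x → g₀ x * χ S x)) (E-* n (½ * sgn β) (λ x → g₁ x * χ S x)) ⟩
  ½ * coeff g₀ S + (½ * sgn β) * coeff g₁ S
    ≡⟨ regroup (coeff g₀ S) (coeff g₁ S) (sgn β) ⟩
  ½ * (coeff g₀ S + sgn β * coeff g₁ S)
    ∎
  where
  open ≡-Reasoning
  g₀ g₁ : Vec Bool n → ℚ
  g₀ x = g (x ∷ʳ false)
  g₁ x = g (x ∷ʳ true)
  split : ∀ x → ½ * (g₀ x * χ (S ∷ʳ β) (x ∷ʳ false) + g₁ x * χ (S ∷ʳ β) (x ∷ʳ true))
              ≡ ½ * (g₀ x * χ S x) + (½ * sgn β) * (g₁ x * χ S x)
  split x rewrite χ-∷ʳ S x β false | χ-∷ʳ S x β true | χ-last-false β | χ-last-true β =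
    pull-out (g₀ x) (g₁ x) (χ S x) (sgn β)
    where
    pull-out : ∀ a b c s → ½ * (a * (c * 1ℚ) + b * (c * s)) ≡ ½ * (a * c) + (½ * s) * (b * c)
    pull-out = solve-∀ ℚ-ring
  regroup : ∀ a b s → ½ * a + (½ * s) * b ≡ ½ * (a + s * b)
  regroup = solve-∀ ℚ-ring

coeff-cong : ∀ {n} {g h : Vec Bool n → ℚ} → (∀ x → g x ≡ h x) → ∀ S → coeff g S ≡ coeff h S
coeff-cong {n} g≗h S = E-cong n (λ x → cong (_* χ S x) (g≗h x))

E-affine : ∀ n a b (g : Vec Bool n → ℚ) → E n (λ x → a + b * g x) ≡ a + b * E n g
E-affine n a b g = trans (E-+ n (λ _ → a) (λ x → b * g x)) (cong₂ _+_ (E-const n a) (E-* n b g))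

parseval : ∀ n (g : Vec Bool n → ℚ) → ΣS n (λ S → coeff g S * coeff g S) ≡ E n (λ x → g x * g x)
parseval zero    g = cong₂ _*_ (*-identityʳ (g [])) (*-identityʳ (g []))
parseval (suc n) g = begin
  ΣS (suc n) (λ T → coeff g T * coeff g T)
    ≡⟨ ΣS-∷ʳ n (λ T → coeff g T * coeff g T) ⟩
  ΣS n (λ S → coeff g (S ∷ʳ false) * coeff g (S ∷ʳ false) + coeff g (S ∷ʳ true) * coeff g (S ∷ʳ true))
    ≡⟨ ΣS-cong n (λ S → trans (cong₂ (λ a b → a * a + b * b) (coeff-∷ʳ g S false) (coeff-∷ʳ g S true))
                              (sum-of-squares (coeff g₀ S) (coeff g₁ S))) ⟩
  ΣS n (λ S → ½ * (coeff g₀ S * coeff g₀ S + coeff g₁ S * coeff g₁ S))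
    ≡⟨ trans (ΣS-* n ½ _) (cong (½ *_) (ΣS-+ n (λ S → coeff g₀ S * coeff g₀ S) _)) ⟩
  ½ * (ΣS n (λ S → coeff g₀ S * coeff g₀ S) + ΣS n (λ S → coeff g₁ S * coeff g₁ S))
    ≡⟨ cong₂ (λ a b → ½ * (a + b)) (parseval n g₀) (parseval n g₁) ⟩
  ½ * (E n (λ x → g₀ x * g₀ x) + E n (λ x → g₁ x * g₁ x))
    ≡⟨ cong (½ *_) (E-+ n (λ x → g₀ x * g₀ x) (λ x → g₁ x * g₁ x)) ⟨
  ½ * E n (λ x → g₀ x * g₀ x + g₁ x * g₁ x)
    ≡⟨ E-* n ½ (λ x → g₀ x * g₀ x + g₁ x * g₁ x) ⟨
  E n (λ x → ½ * (g₀ x * g₀ x + g₁ x * g₁ x))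
    ≡⟨ E-∷ʳ n (λ x → g x * g x) ⟨
  E (suc n) (λ x → g x * g x)
    ∎
  where
  open ≡-Reasoning
  g₀ g₁ : Vec Bool n → ℚ
  g₀ x = g (x ∷ʳ false)
  g₁ x = g (x ∷ʳ true)
  sum-of-squares : ∀ a b → ½ * (a + 1ℚ * b) * (½ * (a + 1ℚ * b)) + ½ * (a + - 1ℚ * b) * (½ * (a + - 1ℚ * b))
                         ≡ ½ * (a * a + b * b)
  sum-of-squares = solve-∀ ℚ-ring

fhat²-sum : ∀ {n} (f : BoolFun n) → ΣS n (λ S → fhat f S * fhat f S) ≡ 1ℚ
fhat²-sum {n} f =
  trans (parseval n (λ x → sgn (f x))) (trans (E-cong n (λ x → sgn² (f x))) (E-const n 1ℚ))
  where
  sgn² : ∀ b → sgn b * sgn b ≡ 1ℚ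
  sgn² true  = refl
  sgn² false = refl

fhat-∅ : ∀ {n} (f : BoolFun n) → fhat f ∅ ≡ 1ℚ - fromℕ 2 * Pr-true f
fhat-∅ {n} f = begin
  E n (λ x → sgn (f x) * χ ∅ x)                                 ≡⟨ E-cong n (λ x → pointwise (f x) (χ-∅ x)) ⟩
  E n (λ x → 1ℚ + - fromℕ 2 * (if f x then 1ℚ else 0ℚ))        ≡⟨ E-affine n 1ℚ (- fromℕ 2) _ ⟩
  1ℚ + - fromℕ 2 * Pr-true f                                    ≡⟨ cong (1ℚ +_) (neg-distribˡ-* (fromℕ 2) (Pr-true f)) ⟨
  1ℚ - fromℕ 2 * Pr-true f                                      ∎
  where
  open ≡-Reasoning
  pointwise : ∀ {c} b → c ≡ 1ℚ → sgn b * c ≡ 1ℚ + - fromℕ 2 * (if b then 1ℚ else 0ℚ)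
  pointwise true  refl = refl
  pointwise false refl = refl

1-Pr-true : ∀ {n} (f : BoolFun n) → 1ℚ - Pr-true f ≡ E n (λ x → if f x then 0ℚ else 1ℚ)
1-Pr-true {n} f = begin
  1ℚ - Pr-true f                                     ≡⟨ cong (λ p → 1ℚ - p) (*-identityˡ (Pr-true f)) ⟨
  1ℚ - 1ℚ * Pr-true f                                ≡⟨ cong (1ℚ +_) (neg-distribˡ-* 1ℚ (Pr-true f)) ⟩
  1ℚ + - 1ℚ * Pr-true f                              ≡⟨ E-affine n 1ℚ (- 1ℚ) _ ⟨
  E n (λ x → 1ℚ + - 1ℚ * (if f x then 1ℚ else 0ℚ))  ≡⟨ E-cong n (λ x → pointwise (f x)) ⟩
  E n (λ x → if f x then 0ℚ else 1ℚ)                 ∎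
  where
  open ≡-Reasoning
  pointwise : ∀ b → 1ℚ + - 1ℚ * (if b then 1ℚ else 0ℚ) ≡ (if b then 0ℚ else 1ℚ)
  pointwise true  = refl
  pointwise false = refl

⊓ι-∷ʳ : ∀ {n} (f : BoolFun n) x β → (f ⊓ι) (x ∷ʳ β) ≡ f x ∧ β
⊓ι-∷ʳ f x β = cong₂ _∧_ (cong f (init-∷ʳ β x)) (last-∷ʳ β x)

⊔ι-∷ʳ : ∀ {n} (f : BoolFun n) x β → (f ⊔ι) (x ∷ʳ β) ≡ f x ∨ β
⊔ι-∷ʳ f x β = cong₂ _∨_ (cong f (init-∷ʳ β x)) (last-∷ʳ β x)

fhat-⊓ι : ∀ {n} (f : BoolFun n) S β → fhat (f ⊓ι) (S ∷ʳ β) ≡ ½ * (δ∅ S + sgn β * fhat f S)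
fhat-⊓ι {n} f S β = begin
  fhat (f ⊓ι) (S ∷ʳ β)                   ≡⟨ coeff-∷ʳ (λ y → sgn ((f ⊓ι) y)) S β ⟩
  ½ * (coeff g₀ S + sgn β * coeff g₁ S)  ≡⟨ cong₂ (λ a b → ½ * (a + sgn β * b)) g₀-coeff g₁-coeff ⟩
  ½ * (δ∅ S + sgn β * fhat f S)          ∎
  where
  open ≡-Reasoning
  g₀ g₁ : Vec Bool n → ℚ
  g₀ x = sgn ((f ⊓ι) (x ∷ʳ false))
  g₁ x = sgn ((f ⊓ι) (x ∷ʳ true))
  g₀-coeff : coeff g₀ S ≡ δ∅ S
  g₀-coeff = trans (coeff-cong (λ x → cong sgn (trans (⊓ι-∷ʳ f x false) (∧-zeroʳ (f x)))) S)
                   (trans (coeff-const 1ℚ S) (*-identityˡ (δ∅ S)))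
  g₁-coeff : coeff g₁ S ≡ fhat f S
  g₁-coeff = coeff-cong (λ x → cong sgn (trans (⊓ι-∷ʳ f x true) (∧-identityʳ (f x)))) S

fhat-⊔ι : ∀ {n} (f : BoolFun n) S β → fhat (f ⊔ι) (S ∷ʳ β) ≡ ½ * (fhat f S + sgn β * - δ∅ S)
fhat-⊔ι {n} f S β = begin
  fhat (f ⊔ι) (S ∷ʳ β)                   ≡⟨ coeff-∷ʳ (λ y → sgn ((f ⊔ι) y)) S β ⟩
  ½ * (coeff g₀ S + sgn β * coeff g₁ S)  ≡⟨ cong₂ (λ a b → ½ * (a + sgn β * b)) g₀-coeff g₁-coeff ⟩
  ½ * (fhat f S + sgn β * - δ∅ S)        ∎
  where
  open ≡-Reasoning
  g₀ g₁ : Vec Bool n → ℚ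
  g₀ x = sgn ((f ⊔ι) (x ∷ʳ false))
  g₁ x = sgn ((f ⊔ι) (x ∷ʳ true))
  g₀-coeff : coeff g₀ S ≡ fhat f S
  g₀-coeff = coeff-cong (λ x → cong sgn (trans (⊔ι-∷ʳ f x false) (∨-identityʳ (f x)))) S
  g₁-coeff : coeff g₁ S ≡ - δ∅ S
  g₁-coeff = trans (coeff-cong (λ x → cong sgn (trans (⊔ι-∷ʳ f x true) (∨-zeroʳ (f x)))) S)
                   (trans (coeff-const (- 1ℚ) S) (trans (sym (neg-distribˡ-* 1ℚ (δ∅ S))) (cong -_ (*-identityˡ (δ∅ S)))))

-- Total influence

Inf-extension : ∀ {n} (G : BoolFun (suc n)) (u v : Vec Bool n → ℚ) →
                (∀ S β → fhat G (S ∷ʳ β) ≡ ½ * (u S + sgn β * v S)) →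
                Inf G ≡ ½ * ΣS n (λ S → (u S * u S + v S * v S) * fromℕ (card S))
                        + ½ * ½ * ΣS n (λ S → (u S - v S) * (u S - v S))
Inf-extension {n} G u v Ĝ = begin
  ΣS (suc n) (λ T → fhat G T * fhat G T * fromℕ (card T))
    ≡⟨ ΣS-∷ʳ n (λ T → fhat G T * fhat G T * fromℕ (card T)) ⟩
  ΣS n (λ S → fhat G (S ∷ʳ false) * fhat G (S ∷ʳ false) * fromℕ (card (S ∷ʳ false))
            + fhat G (S ∷ʳ true) * fhat G (S ∷ʳ true) * fromℕ (card (S ∷ʳ true)))
    ≡⟨ ΣS-cong n pointwise ⟩
  ΣS n (λ S → ½ * ((u S * u S + v S * v S) * fromℕ (card S)) + ½ * ½ * ((u S - v S) * (u S - v S)))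
    ≡⟨ trans (ΣS-+ n _ _) (cong₂ _+_ (ΣS-* n ½ _) (ΣS-* n (½ * ½) _)) ⟩
  ½ * ΣS n (λ S → (u S * u S + v S * v S) * fromℕ (card S)) + ½ * ½ * ΣS n (λ S → (u S - v S) * (u S - v S))
    ∎
  where
  open ≡-Reasoning
  expand : ∀ u v c → ½ * (u + 1ℚ * v) * (½ * (u + 1ℚ * v)) * (c + 0ℚ)
                     + ½ * (u + - 1ℚ * v) * (½ * (u + - 1ℚ * v)) * (c + 1ℚ)
                   ≡ ½ * ((u * u + v * v) * c) + ½ * ½ * ((u - v) * (u - v))
  expand = solve-∀ ℚ-ring
  pointwise : ∀ S → fhat G (S ∷ʳ false) * fhat G (S ∷ʳ false) * fromℕ (card (S ∷ʳ false))
                  + fhat G (S ∷ʳ true) * fhat G (S ∷ʳ true) * fromℕ (card (S ∷ʳ true))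
                  ≡ ½ * ((u S * u S + v S * v S) * fromℕ (card S)) + ½ * ½ * ((u S - v S) * (u S - v S))
  pointwise S rewrite Ĝ S false | Ĝ S true | fromℕ-card-∷ʳ S false | fromℕ-card-∷ʳ S true =
    expand (u S) (v S) (fromℕ (card S))

module _ {n} (f : BoolFun n) where

  ΣS-shifted-square : ∀ s → ΣS n (λ S → (fhat f S + s * δ∅ S) * (fhat f S + s * δ∅ S))
                            ≡ 1ℚ + s * (s + fromℕ 2 * fhat f ∅)
  ΣS-shifted-square s = begin
    ΣS n (λ S → (fhat f S + s * δ∅ S) * (fhat f S + s * δ∅ S))
      ≡⟨ ΣS-cong n (λ S → expand (fhat f S) (δ∅ S) (δ∅-idem S)) ⟩
    ΣS n (λ S → fhat f S * fhat f S + δ∅ S * (s * (s + fromℕ 2 * fhat f S)))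
      ≡⟨ ΣS-+ n (λ S → fhat f S * fhat f S) (λ S → δ∅ S * (s * (s + fromℕ 2 * fhat f S))) ⟩
    ΣS n (λ S → fhat f S * fhat f S) + ΣS n (λ S → δ∅ S * (s * (s + fromℕ 2 * fhat f S)))
      ≡⟨ cong₂ _+_ (fhat²-sum f) (ΣS-δ∅ n (λ S → s * (s + fromℕ 2 * fhat f S))) ⟩
    1ℚ + s * (s + fromℕ 2 * fhat f ∅)
      ∎
    where
    open ≡-Reasoning
    square : ∀ a d s → (a + s * d) * (a + s * d) ≡ a * a + (d * d) * (s * s) + d * (fromℕ 2 * s * a)
    square = solve-∀ ℚ-ring
    regroup : ∀ a d s → a * a + d * (s * s) + d * (fromℕ 2 * s * a) ≡ a * a + d * (s * (s + fromℕ 2 * a))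
    regroup = solve-∀ ℚ-ring
    expand : ∀ a d → d * d ≡ d → (a + s * d) * (a + s * d) ≡ a * a + d * (s * (s + fromℕ 2 * a))
    expand a d d²≡d =
      trans (square a d s) (trans (cong (λ e → a * a + e * (s * s) + d * (fromℕ 2 * s * a)) d²≡d) (regroup a d s))

  Inf-⊓ι : Inf (f ⊓ι) ≡ ½ * Inf f + Pr-true f
  Inf-⊓ι = begin
    Inf (f ⊓ι)
      ≡⟨ Inf-extension (f ⊓ι) δ∅ (fhat f) (fhat-⊓ι f) ⟩
    ½ * ΣS n (λ S → (δ∅ S * δ∅ S + fhat f S * fhat f S) * fromℕ (card S))
      + ½ * ½ * ΣS n (λ S → (δ∅ S - fhat f S) * (δ∅ S - fhat f S))
      ≡⟨ cong₂ (λ a b → ½ * a + ½ * ½ * b) (ΣS-cong n drop-δ∅) (ΣS-cong n (λ S → flip (δ∅ S) (fhat f S))) ⟩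
    ½ * Inf f + ½ * ½ * ΣS n (λ S → (fhat f S + - 1ℚ * δ∅ S) * (fhat f S + - 1ℚ * δ∅ S))
      ≡⟨ cong (λ b → ½ * Inf f + ½ * ½ * b) (ΣS-shifted-square (- 1ℚ)) ⟩
    ½ * Inf f + ½ * ½ * (1ℚ + - 1ℚ * (- 1ℚ + fromℕ 2 * fhat f ∅))
      ≡⟨ cong (λ a → ½ * Inf f + ½ * ½ * (1ℚ + - 1ℚ * (- 1ℚ + fromℕ 2 * a))) (fhat-∅ f) ⟩
    ½ * Inf f + ½ * ½ * (1ℚ + - 1ℚ * (- 1ℚ + fromℕ 2 * (1ℚ - fromℕ 2 * Pr-true f)))
      ≡⟨ simplify (Inf f) (Pr-true f) ⟩
    ½ * Inf f + Pr-true f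
      ∎
    where
    open ≡-Reasoning
    drop-δ∅ : ∀ S → (δ∅ S * δ∅ S + fhat f S * fhat f S) * fromℕ (card S) ≡ fhat f S * fhat f S * fromℕ (card S)
    drop-δ∅ S = trans (cong (_* fromℕ (card S)) (+-comm (δ∅ S * δ∅ S) (fhat f S * fhat f S)))
                      (weighted-δ∅ S (fhat f S * fhat f S))
    flip : ∀ d a → (d - a) * (d - a) ≡ (a + - 1ℚ * d) * (a + - 1ℚ * d)
    flip = solve-∀ ℚ-ring
    simplify : ∀ I p → ½ * I + ½ * ½ * (1ℚ + - 1ℚ * (- 1ℚ + fromℕ 2 * (1ℚ - fromℕ 2 * p))) ≡ ½ * I + p
    simplify = solve-∀ ℚ-ring

  Inf-⊔ι : Inf (f ⊔ι) ≡ ½ * Inf f + (1ℚ - Pr-true f)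
  Inf-⊔ι = begin
    Inf (f ⊔ι)
      ≡⟨ Inf-extension (f ⊔ι) (fhat f) (λ S → - δ∅ S) (fhat-⊔ι f) ⟩
    ½ * ΣS n (λ S → (fhat f S * fhat f S + - δ∅ S * - δ∅ S) * fromℕ (card S))
      + ½ * ½ * ΣS n (λ S → (fhat f S - - δ∅ S) * (fhat f S - - δ∅ S))
      ≡⟨ cong₂ (λ a b → ½ * a + ½ * ½ * b) (ΣS-cong n drop-δ∅) (ΣS-cong n (λ S → flip (δ∅ S) (fhat f S))) ⟩
    ½ * Inf f + ½ * ½ * ΣS n (λ S → (fhat f S + 1ℚ * δ∅ S) * (fhat f S + 1ℚ * δ∅ S))
      ≡⟨ cong (λ b → ½ * Inf f + ½ * ½ * b) (ΣS-shifted-square 1ℚ) ⟩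
    ½ * Inf f + ½ * ½ * (1ℚ + 1ℚ * (1ℚ + fromℕ 2 * fhat f ∅))
      ≡⟨ cong (λ a → ½ * Inf f + ½ * ½ * (1ℚ + 1ℚ * (1ℚ + fromℕ 2 * a))) (fhat-∅ f) ⟩
    ½ * Inf f + ½ * ½ * (1ℚ + 1ℚ * (1ℚ + fromℕ 2 * (1ℚ - fromℕ 2 * Pr-true f)))
      ≡⟨ simplify (Inf f) (Pr-true f) ⟩
    ½ * Inf f + (1ℚ - Pr-true f)
      ∎
    where
    open ≡-Reasoning
    neg-square : ∀ d → - d * - d ≡ d * d
    neg-square = solve-∀ ℚ-ring
    drop-δ∅ : ∀ S → (fhat f S * fhat f S + - δ∅ S * - δ∅ S) * fromℕ (card S) ≡ fhat f S * fhat f S * fromℕ (card S)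
    drop-δ∅ S = trans (cong (λ e → (fhat f S * fhat f S + e) * fromℕ (card S)) (neg-square (δ∅ S)))
                      (weighted-δ∅ S (fhat f S * fhat f S))
    flip : ∀ d a → (a - - d) * (a - - d) ≡ (a + 1ℚ * d) * (a + 1ℚ * d)
    flip = solve-∀ ℚ-ring
    simplify : ∀ I p → ½ * I + ½ * ½ * (1ℚ + 1ℚ * (1ℚ + fromℕ 2 * (1ℚ - fromℕ 2 * p))) ≡ ½ * I + (1ℚ - p)
    simplify = solve-∀ ℚ-ring

-- Dyadic integrality

IsInteger : ℚ → Set
IsInteger x = Σ ℤ λ z → x ≡ fromℤ z

IsNatural : ℚ → Set
IsNatural x = Σ ℕ λ k → x ≡ fromℕ k

IsInteger-+ : ∀ {x y} → IsInteger x → IsInteger y → IsInteger (x + y)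
IsInteger-+ (i , refl) (j , refl) = i ℤ.+ j , sym (fromℤ-+ i j)

IsInteger-* : ∀ {x y} → IsInteger x → IsInteger y → IsInteger (x * y)
IsInteger-* (i , refl) (j , refl) = i ℤ.* j , sym (fromℤ-* i j)

IsNatural-+ : ∀ {x y} → IsNatural x → IsNatural y → IsNatural (x + y)
IsNatural-+ (k , refl) (l , refl) = k ℕ.+ l , sym (fromℕ-+ k l)

IsInteger⇒square-IsNatural : ∀ {x} → IsInteger x → IsNatural (x * x)
IsInteger⇒square-IsNatural (i , refl) =
  ℤ.∣ i ∣ ℕ.* ℤ.∣ i ∣ , trans (sym (fromℤ-* i i)) (trans (cong fromℤ (square-abs i)) (sym (fromℕ≡fromℤ _)))
  where
  square-abs : ∀ i → i ℤ.* i ≡ ℤ.+ (ℤ.∣ i ∣ ℕ.* ℤ.∣ i ∣)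
  square-abs (ℤ.+ k)    = sym (ℤ.pos-* k k)
  square-abs ℤ.-[1+ k ] = refl

sgn-integer : ∀ b → IsInteger (sgn b)
sgn-integer true  = ℤ.-[1+ 0 ] , refl
sgn-integer false = ℤ.+ 1 , refl

χ-integer : ∀ {n} (S x : Vec Bool n) → IsInteger (χ S x)
χ-integer []          []      = ℤ.+ 1 , refl
χ-integer (false ∷ S) (_ ∷ x) = χ-integer S x
χ-integer (true  ∷ S) (b ∷ x) = IsInteger-* (sgn-integer b) (χ-integer S x)

2^n*fhat-integer : ∀ {n} (f : BoolFun n) S → IsInteger (fromℕ (2 ℕ.^ n) * fhat f S)
2^n*fhat-integer {n} f S = subst IsInteger (sym (2^n*E≡ΣS n _))
  (ΣS-closed IsInteger IsInteger-+ n (λ x → IsInteger-* (sgn-integer (f x)) (χ-integer S x)))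

2^n*2^n*fhat²-natural : ∀ {n} (f : BoolFun n) S → IsNatural (fromℕ (2 ℕ.^ n ℕ.* 2 ℕ.^ n) * (fhat f S * fhat f S))
2^n*2^n*fhat²-natural {n} f S = subst IsNatural (sym rearrange) (IsInteger⇒square-IsNatural (2^n*fhat-integer f S))
  where
  N : ℕ
  N = 2 ℕ.^ n
  rearrange : fromℕ (N ℕ.* N) * (fhat f S * fhat f S) ≡ fromℕ N * fhat f S * (fromℕ N * fhat f S)
  rearrange = trans (cong (_* (fhat f S * fhat f S)) (fromℕ-* N N)) (*-interchange-square (fromℕ N) (fhat f S))
    where
    *-interchange-square : ∀ ν x → ν * ν * (x * x) ≡ ν * x * (ν * x)
    *-interchange-square = solve-∀ ℚ-ring

if-natural : ∀ b {x y} → IsNatural x → IsNatural y → IsNatural (if b then x else y)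
if-natural true  x-nat y-nat = x-nat
if-natural false x-nat y-nat = y-nat

2^n*Pr-true-natural : ∀ {n} (f : BoolFun n) → IsNatural (fromℕ (2 ℕ.^ n) * Pr-true f)
2^n*Pr-true-natural {n} f = subst IsNatural (sym (2^n*E≡ΣS n _))
  (ΣS-closed IsNatural IsNatural-+ n (λ x → if-natural (f x) (1 , refl) (0 , refl)))

2^n*Pr-false-natural : ∀ {n} (f : BoolFun n) → IsNatural (fromℕ (2 ℕ.^ n) * (1ℚ - Pr-true f))
2^n*Pr-false-natural {n} f = subst IsNatural (sym (trans (cong (fromℕ (2 ℕ.^ n) *_) (1-Pr-true f)) (2^n*E≡ΣS n _)))
  (ΣS-closed IsNatural IsNatural-+ n (λ x → if-natural (f x) (0 , refl) (1 , refl)))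

-- Formal sums of logarithms

posPart-++ : ∀ D L₁ L₂ → posPart D (L₁ ++ L₂) ≡ posPart D L₁ * posPart D L₂
posPart-++ D []             L₂ = sym (*-identityˡ (posPart D L₂))
posPart-++ D ((c , q) ∷ L₁) L₂ with ↥ ((ℤ.+ D / 1) * c)
... | ℤ.+ k      = trans (cong (powℚ q k *_) (posPart-++ D L₁ L₂))
                         (sym (*-assoc (powℚ q k) (posPart D L₁) (posPart D L₂)))
... | ℤ.-[1+ k ] = posPart-++ D L₁ L₂

negPart-++ : ∀ D L₁ L₂ → negPart D (L₁ ++ L₂) ≡ negPart D L₁ * negPart D L₂
negPart-++ D []             L₂ = sym (*-identityˡ (negPart D L₂))
negPart-++ D ((c , q) ∷ L₁) L₂ with ↥ ((ℤ.+ D / 1) * c)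
... | ℤ.+ k      = negPart-++ D L₁ L₂
... | ℤ.-[1+ k ] = trans (cong (powℚ q (suc k) *_) (negPart-++ D L₁ L₂))
                         (sym (*-assoc (powℚ q (suc k)) (negPart D L₁) (negPart D L₂)))

posPart-∷⁻ : ∀ D c q L k → ↥ ((ℤ.+ D / 1) * c) ≡ ℤ.- ℤ.+ k → posPart D ((c , q) ∷ L) ≡ posPart D L
posPart-∷⁻ D c q L k e with ↥ ((ℤ.+ D / 1) * c)
posPart-∷⁻ D c q L zero    refl | .(ℤ.+ 0) = *-identityˡ (posPart D L)
posPart-∷⁻ D c q L (suc k) refl | .(ℤ.-[1+ k ]) = refl

negPart-∷⁻ : ∀ D c q L k → ↥ ((ℤ.+ D / 1) * c) ≡ ℤ.- ℤ.+ k → negPart D ((c , q) ∷ L) ≡ powℚ q k * negPart D L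
negPart-∷⁻ D c q L k e with ↥ ((ℤ.+ D / 1) * c)
negPart-∷⁻ D c q L zero    refl | .(ℤ.+ 0) = sym (*-identityˡ (negPart D L))
negPart-∷⁻ D c q L (suc k) refl | .(ℤ.-[1+ k ]) = refl

posPart-∷⁺ : ∀ D c q L k → ↥ ((ℤ.+ D / 1) * c) ≡ ℤ.+ k → posPart D ((c , q) ∷ L) ≡ powℚ q k * posPart D L
posPart-∷⁺ D c q L k e with ↥ ((ℤ.+ D / 1) * c)
posPart-∷⁺ D c q L k refl | .(ℤ.+ k) = refl

negPart-∷⁺ : ∀ D c q L k → ↥ ((ℤ.+ D / 1) * c) ≡ ℤ.+ k → negPart D ((c , q) ∷ L) ≡ negPart D L
negPart-∷⁺ D c q L k e with ↥ ((ℤ.+ D / 1) * c)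
negPart-∷⁺ D c q L k refl | .(ℤ.+ k) = refl

-- Every D·c in L is an integer and 2^(D · Σ c log₂ q) = P / N: the terms with D·c ≥ 0 make up P,
-- the others N.
record Exponentiates (D : ℕ) (L : LogSum) (P N : ℚ) : Set where
  field
    integral : IntegralAt D L
    pos      : posPart D L ≡ P
    neg      : negPart D L ≡ N

open Exponentiates

Exponentiates-≡ : ∀ {D L P P′ N N′} → P ≡ P′ → N ≡ N′ → Exponentiates D L P N → Exponentiates D L P′ N′
Exponentiates-≡ P≡P′ N≡N′ e =
  record { integral = integral e ; pos = trans (pos e) P≡P′ ; neg = trans (neg e) N≡N′ }

Exponentiates-++ : ∀ {D L₁ L₂ P₁ P₂ N₁ N₂} → Exponentiates D L₁ P₁ N₁ → Exponentiates D L₂ P₂ N₂ →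
                   Exponentiates D (L₁ ++ L₂) (P₁ * P₂) (N₁ * N₂)
Exponentiates-++ {D} {L₁} {L₂} e₁ e₂ = record
  { integral = ++⁺ (integral e₁) (integral e₂)
  ; pos      = trans (posPart-++ D L₁ L₂) (cong₂ _*_ (pos e₁) (pos e₂))
  ; neg      = trans (negPart-++ D L₁ L₂) (cong₂ _*_ (neg e₁) (neg e₂))
  }

Exponentiates-subsets : ∀ {D} n {F : Vec Bool n → LogSum} {N : Vec Bool n → ℚ} →
                        (∀ S → Exponentiates D (F S) 1ℚ (N S)) →
                        Exponentiates D (concatMap F (subsets n)) 1ℚ (ΠS n N)
Exponentiates-subsets zero    {F} {N} e =
  Exponentiates-≡ (*-identityʳ 1ℚ) (*-identityʳ (N [])) (Exponentiates-++ (e []) empty)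
  where
  empty : ∀ {D} → Exponentiates D [] 1ℚ 1ℚ
  empty = record { integral = [] ; pos = refl ; neg = refl }
Exponentiates-subsets (suc n) {F} e = subst (λ L → Exponentiates _ L 1ℚ _) (sym split)
  (Exponentiates-≡ (*-identityʳ 1ℚ) refl
    (Exponentiates-++ (Exponentiates-subsets n (λ S → e (false ∷ S))) (Exponentiates-subsets n (λ S → e (true ∷ S)))))
  where
  split : concatMap F (subsets (suc n))
        ≡ concatMap (λ S → F (false ∷ S)) (subsets n) ++ concatMap (λ S → F (true ∷ S)) (subsets n)
  split = trans (concatMap-++ F (map (false ∷_) (subsets n)) (map (true ∷_) (subsets n)))
                (cong₂ _++_ (concatMap-map F (false ∷_) (subsets n)) (concatMap-map F (true ∷_) (subsets n)))

clog-exponent⁻ : ∀ {D} c a k → (a ≡ 0ℚ → c ≡ 0ℚ) → fromℕ D * c ≡ - fromℕ k →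
                 Exponentiates D (clog c a) 1ℚ (a ^ k)
clog-exponent⁻ {D} c a k a≡0⇒c≡0 Dc≡-k with a ≟ 0ℚ
... | yes a≡0 = record { integral = [] ; pos = refl ; neg = cong (a ^_) (sym k≡0) }
  where
  k≡0 : k ≡ 0
  k≡0 = fromℕ-injective (neg-injective (trans (sym Dc≡-k)
          (trans (cong (fromℕ D *_) (a≡0⇒c≡0 a≡0)) (*-zeroʳ (fromℕ D)))))
... | no _ = record
  { integral = cong ↧ₙ_ Dc≡-k′ ∷ []
  ; pos      = posPart-∷⁻ D c a [] k (cong ↥_ Dc≡-k′)
  ; neg      = trans (negPart-∷⁻ D c a [] k (cong ↥_ Dc≡-k′)) (trans (*-identityʳ (powℚ a k)) (powℚ≡^ a k))
  }
  where
  Dc≡-k′ : fromℕ D * c ≡ fromℤ (ℤ.- ℤ.+ k)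
  Dc≡-k′ = trans Dc≡-k (-fromℕ≡fromℤ k)

clog-exponent⁺ : ∀ {D} c a k → (a ≡ 0ℚ → c ≡ 0ℚ) → fromℕ D * c ≡ fromℕ k →
                 Exponentiates D (clog c a) (a ^ k) 1ℚ
clog-exponent⁺ {D} c a k a≡0⇒c≡0 Dc≡k with a ≟ 0ℚ
... | yes a≡0 = record { integral = [] ; pos = cong (a ^_) (sym k≡0) ; neg = refl }
  where
  k≡0 : k ≡ 0
  k≡0 = fromℕ-injective (trans (sym Dc≡k) (trans (cong (fromℕ D *_) (a≡0⇒c≡0 a≡0)) (*-zeroʳ (fromℕ D))))
... | no _ = record
  { integral = cong ↧ₙ_ Dc≡k′ ∷ []
  ; pos      = trans (posPart-∷⁺ D c a [] k (cong ↥_ Dc≡k′)) (trans (*-identityʳ (powℚ a k)) (powℚ≡^ a k))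
  ; neg      = negPart-∷⁺ D c a [] k (cong ↥_ Dc≡k′)
  }
  where
  Dc≡k′ : fromℕ D * c ≡ fromℤ (ℤ.+ k)
  Dc≡k′ = trans Dc≡k (fromℕ≡fromℤ k)

scale-clog : ∀ k c a → scale k (clog c a) ≡ clog (k * c) a
scale-clog k c a with a ≟ 0ℚ
... | yes _ = refl
... | no _  = refl

≈L-intro : ∀ {D L₁ L₂ P₁ N₁ P₂ N₂} → D ℕ.≥ 1 → Exponentiates D L₁ P₁ N₁ → Exponentiates D L₂ P₂ N₂ →
           P₁ * N₂ ≡ P₂ * N₁ → L₁ ≈L L₂
≈L-intro {D} D≥1 e₁ e₂ P₁N₂≡P₂N₁ = D , D≥1 , integral e₁ , integral e₂ ,
  trans (cong₂ _*_ (pos e₁) (neg e₂)) (trans P₁N₂≡P₂N₁ (sym (cong₂ _*_ (pos e₂) (neg e₁))))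

^-split₃ : ∀ x {a} b c d → a ≡ b ℕ.+ (c ℕ.+ d) → x ^ a ≡ x ^ b * (x ^ c * x ^ d)
^-split₃ x b c d refl = trans (^-homo-* x b (c ℕ.+ d)) (cong (x ^ b *_) (^-homo-* x c d))

^-scaled-cong : ∀ D {x y} k l → x ≡ y → fromℕ D * x ≡ fromℕ k → fromℕ D * y ≡ fromℕ l → x ^ k ≡ y ^ l
^-scaled-cong D {x} k l refl Dx≡k Dx≡l = cong (x ^_) (fromℕ-injective {k} {l} (trans (sym Dx≡k) Dx≡l))

16^-split : ∀ k → fromℕ 16 ^ k ≡ fromℕ 4 ^ k * fromℕ 4 ^ k
16^-split k = ^-distrib-* (fromℕ 4) (fromℕ 4) k

^-double-quarter : ∀ a k → a ^ (2 ℕ.* k) ≡ fromℕ 16 ^ k * ((½ * ½ * a) ^ k * (½ * ½ * a) ^ k)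
^-double-quarter a k = begin
  a ^ (2 ℕ.* k)                                      ≡⟨ cong (_^ (2 ℕ.* k)) (quarter a) ⟩
  (fromℕ 4 * b) ^ (2 ℕ.* k)                           ≡⟨ cong (λ j → (fromℕ 4 * b) ^ (k ℕ.+ j)) (ℕ.+-identityʳ k) ⟩
  (fromℕ 4 * b) ^ (k ℕ.+ k)                           ≡⟨ ^-homo-* (fromℕ 4 * b) k k ⟩
  (fromℕ 4 * b) ^ k * (fromℕ 4 * b) ^ k               ≡⟨ cong (λ x → x * x) (^-distrib-* (fromℕ 4) b k) ⟩
  fromℕ 4 ^ k * b ^ k * (fromℕ 4 ^ k * b ^ k)         ≡⟨ *-interchange (fromℕ 4 ^ k) (b ^ k) (fromℕ 4 ^ k) (b ^ k) ⟩
  fromℕ 4 ^ k * fromℕ 4 ^ k * (b ^ k * b ^ k)         ≡⟨ cong (_* (b ^ k * b ^ k)) (16^-split k) ⟨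
  fromℕ 16 ^ k * (b ^ k * b ^ k)                      ∎
  where
  open ≡-Reasoning
  b : ℚ
  b = ½ * ½ * a
  quarter : ∀ a → a ≡ fromℕ 4 * (½ * ½ * a)
  quarter = solve-∀ ℚ-ring

-- Raised to the power D = 4N², this is the scalar identity
--   1 + 2p log p + 2q log q = ½ t log t + (1 - t) + 2p² log p + 2q² log q   (t = 4pq, p + q = 1)
-- with p = m/N, q = m′/N and 1 - t = K₀/N²; the exponents of 4, p and q agree on both sides.
power-identity : ∀ (p q : ℚ) (m m′ N K₀ : ℕ) → m ℕ.+ m′ ≡ N → K₀ ℕ.+ 4 ℕ.* (m ℕ.* m′) ≡ N ℕ.* N →
                 fromℕ 16 ^ (N ℕ.* N) * (p ^ (8 ℕ.* (N ℕ.* m)) * q ^ (8 ℕ.* (N ℕ.* m′)))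
                 ≡ (fromℕ 4 * p * q) ^ (2 ℕ.* (4 ℕ.* (m ℕ.* m′))) * fromℕ 16 ^ K₀
                   * ((q * q) ^ (4 ℕ.* (m′ ℕ.* m′)) * (p * p) ^ (4 ℕ.* (m ℕ.* m)))
power-identity p q m m′ N K₀ refl K₀+4mm′≡N² = begin
  fromℕ 16 ^ (N ℕ.* N) * (p ^ (8 ℕ.* (N ℕ.* m)) * q ^ (8 ℕ.* (N ℕ.* m′)))
    ≡⟨ cong₂ _*_ (trans (16^-split (N ℕ.* N)) (sym (^-homo-* (fromℕ 4) (N ℕ.* N) (N ℕ.* N))))
                 (cong₂ _*_ (^-split₃ p k kp kp p-exponent) (^-split₃ q k kq kq q-exponent)) ⟩
  fromℕ 4 ^ (N ℕ.* N ℕ.+ N ℕ.* N) * ((p ^ k * (p ^ kp * p ^ kp)) * (q ^ k * (q ^ kq * q ^ kq)))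
    ≡⟨ cong (_* ((p ^ k * (p ^ kp * p ^ kp)) * (q ^ k * (q ^ kq * q ^ kq))))
            (^-split₃ (fromℕ 4) k K₀ K₀ 4-exponent) ⟩
  fromℕ 4 ^ k * (fromℕ 4 ^ K₀ * fromℕ 4 ^ K₀) * ((p ^ k * (p ^ kp * p ^ kp)) * (q ^ k * (q ^ kq * q ^ kq)))
    ≡⟨ regroup (fromℕ 4 ^ k) (fromℕ 4 ^ K₀) (p ^ k) (p ^ kp) (q ^ k) (q ^ kq) ⟩
  fromℕ 4 ^ k * p ^ k * q ^ k * (fromℕ 4 ^ K₀ * fromℕ 4 ^ K₀) * ((q ^ kq * q ^ kq) * (p ^ kp * p ^ kp))
    ≡⟨ cong₂ (λ x y → x * y * ((q ^ kq * q ^ kq) * (p ^ kp * p ^ kp)))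
             (sym (trans (^-distrib-* (fromℕ 4 * p) q k) (cong (_* q ^ k) (^-distrib-* (fromℕ 4) p k))))
             (sym (16^-split K₀)) ⟩
  (fromℕ 4 * p * q) ^ k * fromℕ 16 ^ K₀ * ((q ^ kq * q ^ kq) * (p ^ kp * p ^ kp))
    ≡⟨ cong₂ (λ x y → (fromℕ 4 * p * q) ^ k * fromℕ 16 ^ K₀ * (x * y))
             (sym (^-distrib-* q q kq)) (sym (^-distrib-* p p kp)) ⟩
  (fromℕ 4 * p * q) ^ k * fromℕ 16 ^ K₀ * ((q * q) ^ kq * (p * p) ^ kp)
    ∎
  where
  open ≡-Reasoning
  k kp kq : ℕ
  k  = 2 ℕ.* (4 ℕ.* (m ℕ.* m′))
  kp = 4 ℕ.* (m ℕ.* m)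
  kq = 4 ℕ.* (m′ ℕ.* m′)
  p-exponent : 8 ℕ.* ((m ℕ.+ m′) ℕ.* m) ≡ k ℕ.+ (kp ℕ.+ kp)
  p-exponent = solve-p m m′
    where
    solve-p : ∀ m m′ → 8 ℕ.* ((m ℕ.+ m′) ℕ.* m)
                     ≡ 2 ℕ.* (4 ℕ.* (m ℕ.* m′)) ℕ.+ (4 ℕ.* (m ℕ.* m) ℕ.+ 4 ℕ.* (m ℕ.* m))
    solve-p = ℕ-Solver.solve-∀
  q-exponent : 8 ℕ.* ((m ℕ.+ m′) ℕ.* m′) ≡ k ℕ.+ (kq ℕ.+ kq)
  q-exponent = solve-q m m′
    where
    solve-q : ∀ m m′ → 8 ℕ.* ((m ℕ.+ m′) ℕ.* m′)
                     ≡ 2 ℕ.* (4 ℕ.* (m ℕ.* m′)) ℕ.+ (4 ℕ.* (m′ ℕ.* m′) ℕ.+ 4 ℕ.* (m′ ℕ.* m′))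
    solve-q = ℕ-Solver.solve-∀
  4-exponent : (m ℕ.+ m′) ℕ.* (m ℕ.+ m′) ℕ.+ (m ℕ.+ m′) ℕ.* (m ℕ.+ m′) ≡ k ℕ.+ (K₀ ℕ.+ K₀)
  4-exponent = trans (cong₂ ℕ._+_ (sym K₀+4mm′≡N²) (sym K₀+4mm′≡N²)) (solve-4 K₀ (m ℕ.* m′))
    where
    solve-4 : ∀ K x → K ℕ.+ 4 ℕ.* x ℕ.+ (K ℕ.+ 4 ℕ.* x) ≡ 2 ℕ.* (4 ℕ.* x) ℕ.+ (K ℕ.+ K)
    solve-4 = ℕ-Solver.solve-∀
  regroup : ∀ f₁ f₂ p₁ p₂ q₁ q₂ → f₁ * (f₂ * f₂) * ((p₁ * (p₂ * p₂)) * (q₁ * (q₂ * q₂)))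
                                 ≡ f₁ * p₁ * q₁ * (f₂ * f₂) * ((q₂ * q₂) * (p₂ * p₂))
  regroup = solve-∀ ℚ-ring

-- Fourier entropy

module _ {n} (f : BoolFun n) where

  private
    N D : ℕ
    N = 2 ℕ.^ n
    D = 2 ℕ.^ suc n ℕ.* 2 ℕ.^ suc n
    ν p q t : ℚ
    ν = fromℕ N
    p = Pr-true f
    q = 1ℚ - p
    t = fromℕ 4 * p * q
    a : Vec Bool n → ℚ
    a S = fhat f S * fhat f S
    m m′ : ℕ
    m  = proj₁ (2^n*Pr-true-natural f)
    m′ = proj₁ (2^n*Pr-false-natural f)
    K : Vec Bool n → ℕ
    K S = proj₁ (2^n*2^n*fhat²-natural f S)
    e-t e-p e-q : ℕ
    e-t = 2 ℕ.* (4 ℕ.* (m ℕ.* m′))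
    e-p = 8 ℕ.* (N ℕ.* m)
    e-q = 8 ℕ.* (N ℕ.* m′)

  νp : ν * p ≡ fromℕ m
  νp = proj₂ (2^n*Pr-true-natural f)

  νq : ν * q ≡ fromℕ m′
  νq = proj₂ (2^n*Pr-false-natural f)

  N²a : ∀ S → fromℕ (N ℕ.* N) * a S ≡ fromℕ (K S)
  N²a S = proj₂ (2^n*2^n*fhat²-natural f S)

  m+m′≡N : m ℕ.+ m′ ≡ N
  m+m′≡N = fromℕ-injective {m ℕ.+ m′} {N} (begin
    fromℕ (m ℕ.+ m′)    ≡⟨ fromℕ-+ m m′ ⟩
    fromℕ m + fromℕ m′  ≡⟨ cong₂ _+_ νp νq ⟨
    ν * p + ν * q       ≡⟨ split-ν ν p ⟨
    ν                   ∎)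
    where
    open ≡-Reasoning
    split-ν : ∀ ν p → ν ≡ ν * p + ν * (1ℚ - p)
    split-ν = solve-∀ ℚ-ring

  N²-scaled : ∀ {x y} k l → ν * x ≡ fromℕ k → ν * y ≡ fromℕ l →
              fromℕ (N ℕ.* N) * (x * y) ≡ fromℕ (k ℕ.* l)
  N²-scaled {x} {y} k l νx νy = begin
    fromℕ (N ℕ.* N) * (x * y)  ≡⟨ cong (_* (x * y)) (fromℕ-* N N) ⟩
    ν * ν * (x * y)            ≡⟨ interchange ν x y ⟩
    ν * x * (ν * y)            ≡⟨ cong₂ _*_ νx νy ⟩
    fromℕ k * fromℕ l          ≡⟨ fromℕ-* k l ⟨
    fromℕ (k ℕ.* l)            ∎
    where
    open ≡-Reasoning
    interchange : ∀ ν x y → ν * ν * (x * y) ≡ ν * x * (ν * y)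
    interchange = solve-∀ ℚ-ring

  N²t : fromℕ (N ℕ.* N) * t ≡ fromℕ (4 ℕ.* (m ℕ.* m′))
  N²t = begin
    fromℕ (N ℕ.* N) * (fromℕ 4 * p * q)  ≡⟨ pull-4 (fromℕ (N ℕ.* N)) p q ⟩
    fromℕ 4 * (fromℕ (N ℕ.* N) * (p * q)) ≡⟨ cong (fromℕ 4 *_) (N²-scaled m m′ νp νq) ⟩
    fromℕ 4 * fromℕ (m ℕ.* m′)            ≡⟨ fromℕ-* 4 (m ℕ.* m′) ⟨
    fromℕ (4 ℕ.* (m ℕ.* m′))              ∎
    where
    open ≡-Reasoning
    pull-4 : ∀ c p q → c * (fromℕ 4 * p * q) ≡ fromℕ 4 * (c * (p * q))
    pull-4 = solve-∀ ℚ-ring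

  1-t≡a∅ : 1ℚ - t ≡ a ∅
  1-t≡a∅ = trans (square-completion p) (cong (λ x → x * x) (sym (fhat-∅ f)))
    where
    square-completion : ∀ p → 1ℚ - fromℕ 4 * p * (1ℚ - p) ≡ (1ℚ - fromℕ 2 * p) * (1ℚ - fromℕ 2 * p)
    square-completion = solve-∀ ℚ-ring

  K∅+4mm′≡N² : K ∅ ℕ.+ 4 ℕ.* (m ℕ.* m′) ≡ N ℕ.* N
  K∅+4mm′≡N² = fromℕ-injective {K ∅ ℕ.+ 4 ℕ.* (m ℕ.* m′)} {N ℕ.* N} (begin
    fromℕ (K ∅ ℕ.+ 4 ℕ.* (m ℕ.* m′))                 ≡⟨ fromℕ-+ (K ∅) (4 ℕ.* (m ℕ.* m′)) ⟩
    fromℕ (K ∅) + fromℕ (4 ℕ.* (m ℕ.* m′))           ≡⟨ cong₂ _+_ (N²a ∅) N²t ⟨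
    fromℕ (N ℕ.* N) * a ∅ + fromℕ (N ℕ.* N) * t      ≡⟨ *-distribˡ-+ (fromℕ (N ℕ.* N)) (a ∅) t ⟨
    fromℕ (N ℕ.* N) * (a ∅ + t)                       ≡⟨ cong (λ x → fromℕ (N ℕ.* N) * (x + t)) 1-t≡a∅ ⟨
    fromℕ (N ℕ.* N) * (1ℚ - t + t)                    ≡⟨ cong (fromℕ (N ℕ.* N) *_) (cancel t) ⟩
    fromℕ (N ℕ.* N) * 1ℚ                              ≡⟨ *-identityʳ (fromℕ (N ℕ.* N)) ⟩
    fromℕ (N ℕ.* N)                                   ∎)
    where
    open ≡-Reasoning
    cancel : ∀ t → 1ℚ - t + t ≡ 1ℚ
    cancel = solve-∀ ℚ-ring

  ΣK≡N² : Σℕ n K ≡ N ℕ.* N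
  ΣK≡N² = fromℕ-injective {Σℕ n K} {N ℕ.* N} (begin
    fromℕ (Σℕ n K)                          ≡⟨ ΣS-fromℕ n K ⟨
    ΣS n (λ S → fromℕ (K S))                ≡⟨ ΣS-cong n N²a ⟨
    ΣS n (λ S → fromℕ (N ℕ.* N) * a S)      ≡⟨ ΣS-* n (fromℕ (N ℕ.* N)) a ⟩
    fromℕ (N ℕ.* N) * ΣS n a                ≡⟨ cong (fromℕ (N ℕ.* N) *_) (fhat²-sum f) ⟩
    fromℕ (N ℕ.* N) * 1ℚ                    ≡⟨ *-identityʳ (fromℕ (N ℕ.* N)) ⟩
    fromℕ (N ℕ.* N)                         ∎)
    where open ≡-Reasoning

  fromℕ-D : fromℕ D ≡ fromℕ 4 * fromℕ (N ℕ.* N)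
  fromℕ-D = begin
    fromℕ (2 ℕ.* N ℕ.* (2 ℕ.* N))               ≡⟨ fromℕ-* (2 ℕ.* N) (2 ℕ.* N) ⟩
    fromℕ (2 ℕ.* N) * fromℕ (2 ℕ.* N)           ≡⟨ cong₂ _*_ (fromℕ-* 2 N) (fromℕ-* 2 N) ⟩
    fromℕ 2 * ν * (fromℕ 2 * ν)                 ≡⟨ regroup ν ⟩
    fromℕ 4 * (ν * ν)                           ≡⟨ cong (fromℕ 4 *_) (fromℕ-* N N) ⟨
    fromℕ 4 * fromℕ (N ℕ.* N)                   ∎
    where
    open ≡-Reasoning
    regroup : ∀ ν → fromℕ 2 * ν * (fromℕ 2 * ν) ≡ fromℕ 4 * (ν * ν)
    regroup = solve-∀ ℚ-ring

  D-exponent : ∀ {y} c x k → y ≡ c * x → fromℕ (N ℕ.* N) * x ≡ fromℕ k →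
               fromℕ D * y ≡ fromℕ 4 * c * fromℕ k
  D-exponent c x k refl N²x≡k = begin
    fromℕ D * (c * x)                          ≡⟨ cong (_* (c * x)) fromℕ-D ⟩
    fromℕ 4 * fromℕ (N ℕ.* N) * (c * x)        ≡⟨ regroup (fromℕ (N ℕ.* N)) c x ⟩
    fromℕ 4 * c * (fromℕ (N ℕ.* N) * x)        ≡⟨ cong (fromℕ 4 * c *_) N²x≡k ⟩
    fromℕ 4 * c * fromℕ k                      ∎
    where
    open ≡-Reasoning
    regroup : ∀ M c x → fromℕ 4 * M * (c * x) ≡ fromℕ 4 * c * (M * x)
    regroup = solve-∀ ℚ-ring

  D-exponent⁺ : ∀ {y} c x k σ → y ≡ c * x → fromℕ (N ℕ.* N) * x ≡ fromℕ k → fromℕ 4 * c ≡ fromℕ σ →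
                fromℕ D * y ≡ fromℕ (σ ℕ.* k)
  D-exponent⁺ c x k σ y≡cx N²x≡k 4c≡σ =
    trans (D-exponent c x k y≡cx N²x≡k) (trans (cong (_* fromℕ k) 4c≡σ) (sym (fromℕ-* σ k)))

  D-exponent⁻ : ∀ {y} c x k σ → y ≡ c * x → fromℕ (N ℕ.* N) * x ≡ fromℕ k → fromℕ 4 * c ≡ - fromℕ σ →
                fromℕ D * y ≡ - fromℕ (σ ℕ.* k)
  D-exponent⁻ c x k σ y≡cx N²x≡k 4c≡-σ =
    trans (D-exponent c x k y≡cx N²x≡k)
          (trans (cong (_* fromℕ k) 4c≡-σ)
                 (trans (sym (neg-distribˡ-* (fromℕ σ) (fromℕ k))) (cong (λ x → - x) (sym (fromℕ-* σ k)))))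

  N²p : fromℕ (N ℕ.* N) * p ≡ fromℕ (N ℕ.* m)
  N²p = begin
    fromℕ (N ℕ.* N) * p  ≡⟨ cong (_* p) (fromℕ-* N N) ⟩
    ν * ν * p            ≡⟨ *-assoc ν ν p ⟩
    ν * (ν * p)          ≡⟨ cong (ν *_) νp ⟩
    ν * fromℕ m          ≡⟨ fromℕ-* N m ⟨
    fromℕ (N ℕ.* m)      ∎
    where open ≡-Reasoning

  N²q : fromℕ (N ℕ.* N) * q ≡ fromℕ (N ℕ.* m′)
  N²q = begin
    fromℕ (N ℕ.* N) * q  ≡⟨ cong (_* q) (fromℕ-* N N) ⟩
    ν * ν * q            ≡⟨ *-assoc ν ν q ⟩
    ν * (ν * q)          ≡⟨ cong (ν *_) νq ⟩
    ν * fromℕ m′         ≡⟨ fromℕ-* N m′ ⟨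
    fromℕ (N ℕ.* m′)     ∎
    where open ≡-Reasoning

  private
    move-neg : ∀ s x → s * - x ≡ - s * x
    move-neg s x = trans (sym (neg-distribʳ-* s x)) (neg-distribˡ-* s x)

  scale-Ent : scale ½ (Ent f) ≡ concatMap (λ S → clog (½ * - a S) (a S)) (subsets n)
  scale-Ent = trans (map-concatMap _ (λ S → clog (- a S) (a S)) (subsets n))
                    (concatMap-cong (λ S → scale-clog ½ (- a S) (a S)) (subsets n))

  entRHS-exponentiates : Exponentiates D (entRHS f)
    (1ℚ * ((t ^ e-t * (1ℚ - t) ^ (2 ℕ.* K ∅)) * (1ℚ * 1ℚ)))
    (ΠS n (λ S → a S ^ (2 ℕ.* K S)) * ((1ℚ * 1ℚ) * (p ^ e-p * q ^ e-q)))
  entRHS-exponentiates = Exponentiates-++ half-Ent (Exponentiates-++ htilde-part hbin-part)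
    where
    half-Ent : Exponentiates D (scale ½ (Ent f)) 1ℚ (ΠS n (λ S → a S ^ (2 ℕ.* K S)))
    half-Ent = subst (λ L → Exponentiates D L 1ℚ (ΠS n (λ S → a S ^ (2 ℕ.* K S)))) (sym scale-Ent)
      (Exponentiates-subsets n (λ S →
        clog-exponent⁻ (½ * - a S) (a S) (2 ℕ.* K S) (λ a≡0 → cong (λ x → ½ * - x) a≡0)
          (D-exponent⁻ -½ (a S) (K S) 2 (move-neg ½ (a S)) (N²a S) refl)))
    htilde-part : Exponentiates D (scale -½ (htilde p)) (t ^ e-t * (1ℚ - t) ^ (2 ℕ.* K ∅)) (1ℚ * 1ℚ)
    htilde-part = subst (λ L → Exponentiates D L (t ^ e-t * (1ℚ - t) ^ (2 ℕ.* K ∅)) (1ℚ * 1ℚ))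
      (sym (trans (map-++ _ (clog (- t) t) (clog (- (1ℚ - t)) (1ℚ - t)))
                  (cong₂ _++_ (scale-clog -½ (- t) t) (scale-clog -½ (- (1ℚ - t)) (1ℚ - t)))))
      (Exponentiates-++
        (clog-exponent⁺ (-½ * - t) t e-t (λ t≡0 → cong (λ x → -½ * - x) t≡0)
          (D-exponent⁺ ½ t (4 ℕ.* (m ℕ.* m′)) 2 (move-neg -½ t) N²t refl))
        (clog-exponent⁺ (-½ * - (1ℚ - t)) (1ℚ - t) (2 ℕ.* K ∅) (λ 1-t≡0 → cong (λ x → -½ * - x) 1-t≡0)
          (D-exponent⁺ ½ (a ∅) (K ∅) 2 (trans (move-neg -½ (1ℚ - t)) (cong (½ *_) 1-t≡a∅)) (N²a ∅) refl)))
    hbin-part : Exponentiates D (scale (fromℕ 2) (hbin p)) (1ℚ * 1ℚ) (p ^ e-p * q ^ e-q)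
    hbin-part = subst (λ L → Exponentiates D L (1ℚ * 1ℚ) (p ^ e-p * q ^ e-q))
      (sym (trans (map-++ _ (clog (- p) p) (clog (- q) q))
                  (cong₂ _++_ (scale-clog (fromℕ 2) (- p) p) (scale-clog (fromℕ 2) (- q) q))))
      (Exponentiates-++
        (clog-exponent⁻ (fromℕ 2 * - p) p e-p (λ p≡0 → cong (λ x → fromℕ 2 * - x) p≡0)
          (D-exponent⁻ (- fromℕ 2) p (N ℕ.* m) 8 (move-neg (fromℕ 2) p) N²p refl))
        (clog-exponent⁻ (fromℕ 2 * - q) q e-q (λ q≡0 → cong (λ x → fromℕ 2 * - x) q≡0)
          (D-exponent⁻ (- fromℕ 2) q (N ℕ.* m′) 8 (move-neg (fromℕ 2) q) N²q refl)))

  private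
    Z : Vec Bool n → ℚ
    Z S = (½ * ½ * a S) ^ K S * (½ * ½ * a S) ^ K S

  ΠS-a^2K : ΠS n (λ S → a S ^ (2 ℕ.* K S)) ≡ fromℕ 16 ^ (N ℕ.* N) * (Z ∅ * ΠS⁺ n Z)
  ΠS-a^2K = begin
    ΠS n (λ S → a S ^ (2 ℕ.* K S))                 ≡⟨ ΠS-cong n (λ S → ^-double-quarter (a S) (K S)) ⟩
    ΠS n (λ S → fromℕ 16 ^ K S * Z S)              ≡⟨ ΠS-* n (λ S → fromℕ 16 ^ K S) Z ⟩
    ΠS n (λ S → fromℕ 16 ^ K S) * ΠS n Z           ≡⟨ cong₂ _*_ (ΠS-^ n (fromℕ 16) K) (ΠS-∅ n Z) ⟩
    fromℕ 16 ^ Σℕ n K * (Z ∅ * ΠS⁺ n Z)            ≡⟨ cong (λ k → fromℕ 16 ^ k * (Z ∅ * ΠS⁺ n Z)) ΣK≡N² ⟩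
    fromℕ 16 ^ (N ℕ.* N) * (Z ∅ * ΠS⁺ n Z)         ∎
    where open ≡-Reasoning

  D-quarter-a : ∀ S → fromℕ D * (½ * ½ * a S) ≡ fromℕ (K S)
  D-quarter-a S = trans (D-exponent⁺ (½ * ½) (a S) (K S) 1 refl (N²a S) refl) (cong fromℕ (ℕ.*-identityˡ (K S)))

  D-square : ∀ {x} k → ν * x ≡ fromℕ k → fromℕ D * (x * x) ≡ fromℕ (4 ℕ.* (k ℕ.* k))
  D-square {x} k νx≡k =
    D-exponent⁺ 1ℚ (x * x) (k ℕ.* k) 4 (sym (*-identityˡ (x * x))) (N²-scaled k k νx≡k νx≡k) refl

  swap : ∀ σ (h : Bool → ℚ) → h false * h true ≡ h σ * h (not σ)
  swap false h = refl
  swap true  h = *-comm (h false) (h true)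

  Ent-extension : ∀ (G : BoolFun (suc n)) σ →
    (∀ S β → δ∅ S ≡ 0ℚ → fhat G (S ∷ʳ β) * fhat G (S ∷ʳ β) ≡ ½ * ½ * a S) →
    fhat G (∅ ∷ʳ σ) * fhat G (∅ ∷ʳ σ) ≡ q * q →
    fhat G (∅ ∷ʳ not σ) * fhat G (∅ ∷ʳ not σ) ≡ p * p →
    Ent G ≈L entRHS f
  Ent-extension G σ b-nonempty b-q b-p =
    ≈L-intro D≥1 (Exponentiates-≡ refl ΠS-b^K Ent-exponentiates) entRHS-exponentiates cross-product
    where
    b : Vec Bool (suc n) → ℚ
    b T = fhat G T * fhat G T
    KG : Vec Bool (suc n) → ℕ
    KG T = proj₁ (2^n*2^n*fhat²-natural G T)
    Db≡KG : ∀ T → fromℕ D * b T ≡ fromℕ (KG T)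
    Db≡KG T = proj₂ (2^n*2^n*fhat²-natural G T)
    D≥1 : D ℕ.≥ 1
    D≥1 = ℕ.*-mono-≤ (ℕ.m^n>0 2 (suc n)) (ℕ.m^n>0 2 (suc n))

    Ent-exponentiates : Exponentiates D (Ent G) 1ℚ (ΠS (suc n) (λ T → b T ^ KG T))
    Ent-exponentiates = Exponentiates-subsets (suc n) (λ T →
      clog-exponent⁻ (- b T) (b T) (KG T) (cong (λ x → - x))
        (trans (sym (neg-distribʳ-* (fromℕ D) (b T))) (cong (λ x → - x) (Db≡KG T))))

    Q∅ : ℚ
    Q∅ = (q * q) ^ (4 ℕ.* (m′ ℕ.* m′)) * (p * p) ^ (4 ℕ.* (m ℕ.* m))
    pair : Vec Bool n → ℚ
    pair S = b (S ∷ʳ false) ^ KG (S ∷ʳ false) * b (S ∷ʳ true) ^ KG (S ∷ʳ true)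

    pair-∅ : pair ∅ ≡ Q∅
    pair-∅ = trans (swap σ (λ β → b (∅ ∷ʳ β) ^ KG (∅ ∷ʳ β)))
      (cong₂ _*_
        (^-scaled-cong D (KG (∅ ∷ʳ σ)) (4 ℕ.* (m′ ℕ.* m′)) b-q (Db≡KG (∅ ∷ʳ σ)) (D-square m′ νq))
        (^-scaled-cong D (KG (∅ ∷ʳ not σ)) (4 ℕ.* (m ℕ.* m)) b-p (Db≡KG (∅ ∷ʳ not σ)) (D-square m νp)))
    pair-nonempty : ∀ S → δ∅ S ≡ 0ℚ → pair S ≡ Z S
    pair-nonempty S δ≡0 = cong₂ _*_
      (^-scaled-cong D (KG (S ∷ʳ false)) (K S) (b-nonempty S false δ≡0) (Db≡KG (S ∷ʳ false)) (D-quarter-a S))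
      (^-scaled-cong D (KG (S ∷ʳ true)) (K S) (b-nonempty S true δ≡0) (Db≡KG (S ∷ʳ true)) (D-quarter-a S))

    ΠS-b^K : ΠS (suc n) (λ T → b T ^ KG T) ≡ Q∅ * ΠS⁺ n Z
    ΠS-b^K = begin
      ΠS (suc n) (λ T → b T ^ KG T)  ≡⟨ ΠS-∷ʳ n (λ T → b T ^ KG T) ⟩
      ΠS n pair                      ≡⟨ ΠS-∅ n pair ⟩
      pair ∅ * ΠS⁺ n pair            ≡⟨ cong₂ _*_ pair-∅ (ΠS⁺-cong n pair-nonempty) ⟩
      Q∅ * ΠS⁺ n Z                   ∎
      where open ≡-Reasoning

    P′ Q′ T′ : ℚ
    P′ = p ^ e-p
    Q′ = q ^ e-q
    T′ = t ^ e-t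

    cross-product : 1ℚ * (ΠS n (λ S → a S ^ (2 ℕ.* K S)) * ((1ℚ * 1ℚ) * (P′ * Q′)))
                  ≡ 1ℚ * ((T′ * (1ℚ - t) ^ (2 ℕ.* K ∅)) * (1ℚ * 1ℚ)) * (Q∅ * ΠS⁺ n Z)
    cross-product = begin
      1ℚ * (ΠS n (λ S → a S ^ (2 ℕ.* K S)) * ((1ℚ * 1ℚ) * (P′ * Q′)))
        ≡⟨ cong (λ x → 1ℚ * (x * ((1ℚ * 1ℚ) * (P′ * Q′)))) ΠS-a^2K ⟩
      1ℚ * (fromℕ 16 ^ (N ℕ.* N) * (Z ∅ * ΠS⁺ n Z) * ((1ℚ * 1ℚ) * (P′ * Q′)))
        ≡⟨ rearrange₁ (fromℕ 16 ^ (N ℕ.* N)) (Z ∅) (ΠS⁺ n Z) (P′ * Q′) ⟩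
      Z ∅ * ΠS⁺ n Z * (fromℕ 16 ^ (N ℕ.* N) * (P′ * Q′))
        ≡⟨ cong (Z ∅ * ΠS⁺ n Z *_) (power-identity p q m m′ N (K ∅) m+m′≡N K∅+4mm′≡N²) ⟩
      Z ∅ * ΠS⁺ n Z * (T′ * fromℕ 16 ^ K ∅ * Q∅)
        ≡⟨ rearrange₂ (Z ∅) (ΠS⁺ n Z) T′ (fromℕ 16 ^ K ∅) Q∅ ⟩
      1ℚ * ((T′ * (fromℕ 16 ^ K ∅ * Z ∅)) * (1ℚ * 1ℚ)) * (Q∅ * ΠS⁺ n Z)
        ≡⟨ cong (λ x → 1ℚ * ((T′ * x) * (1ℚ * 1ℚ)) * (Q∅ * ΠS⁺ n Z))
                (sym (trans (cong (_^ (2 ℕ.* K ∅)) 1-t≡a∅) (^-double-quarter (a ∅) (K ∅)))) ⟩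
      1ℚ * ((T′ * (1ℚ - t) ^ (2 ℕ.* K ∅)) * (1ℚ * 1ℚ)) * (Q∅ * ΠS⁺ n Z)
        ∎
      where
      open ≡-Reasoning
      rearrange₁ : ∀ A z x r → 1ℚ * (A * (z * x) * ((1ℚ * 1ℚ) * r)) ≡ z * x * (A * r)
      rearrange₁ = solve-∀ ℚ-ring
      rearrange₂ : ∀ z x τ φ κ → z * x * (τ * φ * κ) ≡ 1ℚ * ((τ * (φ * z)) * (1ℚ * 1ℚ)) * (κ * x)
      rearrange₂ = solve-∀ ℚ-ring

  Ent-⊓ι : Ent (f ⊓ι) ≈L entRHS f
  Ent-⊓ι = Ent-extension (f ⊓ι) false nonempty
             (trans (cong square (∅-coeff false)) (q-square p)) (trans (cong square (∅-coeff true)) (p-square p))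
    where
    square : ℚ → ℚ
    square x = x * x
    nonempty : ∀ S β → δ∅ S ≡ 0ℚ → square (fhat (f ⊓ι) (S ∷ʳ β)) ≡ ½ * ½ * a S
    nonempty S β δ∅S≡0 =
      trans (cong square (trans (fhat-⊓ι f S β) (cong (λ d → ½ * (d + sgn β * fhat f S)) δ∅S≡0))) (halve β (fhat f S))
      where
      halve : ∀ β x → ½ * (0ℚ + sgn β * x) * (½ * (0ℚ + sgn β * x)) ≡ ½ * ½ * (x * x)
      halve false = solve-∀ ℚ-ring
      halve true  = solve-∀ ℚ-ring
    ∅-coeff : ∀ β → fhat (f ⊓ι) (∅ ∷ʳ β) ≡ ½ * (1ℚ + sgn β * (1ℚ - fromℕ 2 * p))
    ∅-coeff β = trans (fhat-⊓ι f ∅ β) (cong₂ (λ d x → ½ * (d + sgn β * x)) (δ∅-∅ n) (fhat-∅ f))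
    q-square : ∀ p → ½ * (1ℚ + 1ℚ * (1ℚ - fromℕ 2 * p)) * (½ * (1ℚ + 1ℚ * (1ℚ - fromℕ 2 * p)))
                   ≡ (1ℚ - p) * (1ℚ - p)
    q-square = solve-∀ ℚ-ring
    p-square : ∀ p → ½ * (1ℚ + - 1ℚ * (1ℚ - fromℕ 2 * p)) * (½ * (1ℚ + - 1ℚ * (1ℚ - fromℕ 2 * p))) ≡ p * p
    p-square = solve-∀ ℚ-ring

  Ent-⊔ι : Ent (f ⊔ι) ≈L entRHS f
  Ent-⊔ι = Ent-extension (f ⊔ι) true nonempty
             (trans (cong square (∅-coeff true)) (q-square p)) (trans (cong square (∅-coeff false)) (p-square p))
    where
    square : ℚ → ℚ
    square x = x * x
    nonempty : ∀ S β → δ∅ S ≡ 0ℚ → square (fhat (f ⊔ι) (S ∷ʳ β)) ≡ ½ * ½ * a S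
    nonempty S β δ∅S≡0 =
      trans (cong square (trans (fhat-⊔ι f S β) (cong (λ d → ½ * (fhat f S + sgn β * - d)) δ∅S≡0))) (halve β (fhat f S))
      where
      halve : ∀ β x → ½ * (x + sgn β * - 0ℚ) * (½ * (x + sgn β * - 0ℚ)) ≡ ½ * ½ * (x * x)
      halve false = solve-∀ ℚ-ring
      halve true  = solve-∀ ℚ-ring
    ∅-coeff : ∀ β → fhat (f ⊔ι) (∅ ∷ʳ β) ≡ ½ * ((1ℚ - fromℕ 2 * p) + sgn β * - 1ℚ)
    ∅-coeff β = trans (fhat-⊔ι f ∅ β) (cong₂ (λ x d → ½ * (x + sgn β * - d)) (fhat-∅ f) (δ∅-∅ n))
    q-square : ∀ p → ½ * ((1ℚ - fromℕ 2 * p) + - 1ℚ * - 1ℚ) * (½ * ((1ℚ - fromℕ 2 * p) + - 1ℚ * - 1ℚ))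
                   ≡ (1ℚ - p) * (1ℚ - p)
    q-square = solve-∀ ℚ-ring
    p-square : ∀ p → ½ * ((1ℚ - fromℕ 2 * p) + 1ℚ * - 1ℚ) * (½ * ((1ℚ - fromℕ 2 * p) + 1ℚ * - 1ℚ)) ≡ p * p
    p-square = solve-∀ ℚ-ring

corollary13 : (n : ℕ) (f : BoolFun n) →
    (Inf (f ⊓ι) ≡ ½ * Inf f + Pr-true f) ×
    (Inf (f ⊔ι) ≡ ½ * Inf f + (1ℚ - Pr-true f)) ×
    (Ent (f ⊓ι) ≈L entRHS f) ×
    (Ent (f ⊔ι) ≈L entRHS f)
corollary13 n f = Inf-⊓ι f , Inf-⊔ι f , Ent-⊓ι f , Ent-⊔ι f
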